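{- Let $k$ be a positive even integer. For every constant $\epsilon>0$, no deterministic online algorithm is $\left(1-\frac{2}{k+2}+\epsilon\right)$-competitive for the maximum-cardinality online matching problem under edge arrivals with a hard budget of $k$ on the number of reassignments.
   Context: Problem. Let $G=(V,E)$ be a graph, not necessarily bipartite. The algorithm initially knows $V$ and $k$. Over $|E|$ timesteps the edges of $G$ arrive one at a time. At the end of each timestep the algorithm must output a matching in the current graph (with vertex set $V$ and the edges revealed so far), obtained from its previous matching (initially $\emptyset$) by at most $k$ (re)assignments, where the number of (re)assignments needed to go from matching $M_1$ to matching $M_2$ is the number of vertices incident to at least one edge of $M_1\triangle M_2$. Once a vertex is matched it must remain matched at all later timesteps. An algorithm is $\rho$-competitive if there is a constant $c\ge0$ such that on every instance the final matching has cardinality at least $\rho\cdot\mathsf{OPT}-c$, where $\mathsf{OPT}$ is the maximum cardinality of a matching in $G$.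
   Formalization: The constant $\epsilon$ ranges over the positive rationals, and the additive constant $c$ in the definition of competitiveness is taken in the rationals. -}

module Defs where

open import Data.Bool using (Bool; true; false; _∧_; _∨_; _xor_; T; if_then_else_)
open import Data.Nat using (ℕ; zero; suc) renaming (_<_ to _<ℕ_; _≤_ to _≤ℕ_; _+_ to _+ℕ_)
open import Data.Fin using (Fin; _≟_)
open import Data.Product using (_×_; _,_; Σ; ∃; ∃-syntax; proj₁; proj₂)
open import Data.Empty using (⊥)
open import Data.List using (List; []; _∷_; _++_; length; take; concatMap; allFin)
open import Data.Bool.ListAction using (any)
open import Data.List.Relation.Unary.All using (All)
open import Data.List.Relation.Unary.AllPairs using (AllPairs)
open import Data.List.Relation.Unary.Unique.Propositional using (Unique)
open import Data.List.Membership.Propositional using (_∈_)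
open import Data.Integer using (+_)
open import Data.Rational using (ℚ; _/_; _+_; _-_; _*_; _≤_; _<_; 0ℚ; 1ℚ)
open import Relation.Nullary using (¬_)
open import Relation.Nullary.Decidable using (⌊_⌋)
open import Relation.Binary.PropositionalEquality using (_≡_; _≢_)

-- The vertex set is V = Fin n. An edge {u,v} is represented by an ordered
-- pair (u , v); two pairs denote the same edge iff they agree up to swapping.
Edge : ℕ → Set
Edge n = Fin n × Fin n

sameEdge : ∀ {n} → Edge n → Edge n → Bool
sameEdge (u , v) (u' , v') =
  (⌊ u ≟ u' ⌋ ∧ ⌊ v ≟ v' ⌋) ∨ (⌊ u ≟ v' ⌋ ∧ ⌊ v ≟ u' ⌋)

memE : ∀ {n} → Edge n → List (Edge n) → Bool
memE e es = any (sameEdge e) es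

-- An instance: a list of edges, arriving in this order; it must describe a
-- simple graph (no loops, no edge listed twice).
SimpleGraph : ∀ {n} → List (Edge n) → Set
SimpleGraph {n} es =
  All (λ e → proj₁ e ≢ proj₂ e) es
  × AllPairs (λ e f → T (sameEdge e f) → ⊥) es

endpoints : ∀ {n} → List (Edge n) → List (Fin n)
endpoints = concatMap (λ e → proj₁ e ∷ proj₂ e ∷ [])

IsMatching : ∀ {n} → List (Edge n) → List (Edge n) → Set
IsMatching es M = All (λ e → T (memE e es)) M × Unique (endpoints M)

size : ∀ {n} → List (Edge n) → ℕ
size = length

Covered : ∀ {n} → Fin n → List (Edge n) → Set
Covered x M = x ∈ endpoints M

incident : ∀ {n} → Fin n → Edge n → Bool
incident x (u , v) = ⌊ x ≟ u ⌋ ∨ ⌊ x ≟ v ⌋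

touched : ∀ {n} → List (Edge n) → List (Edge n) → Fin n → Bool
touched M₁ M₂ x = any (λ e → incident x e ∧ (memE e M₁ xor memE e M₂)) (M₁ ++ M₂)

countB : ∀ {A : Set} → (A → Bool) → List A → ℕ
countB p [] = 0
countB p (a ∷ as) = if p a then suc (countB p as) else countB p as

reassignments : ∀ {n} → List (Edge n) → List (Edge n) → ℕ
reassignments {n} M₁ M₂ = countB (touched M₁ M₂) (allFin n)

IsOPT : ∀ {n} → List (Edge n) → ℕ → Set
IsOPT {n} es m =
  (∃[ M ] (IsMatching es M × size M ≡ m))
  × (∀ (M : List (Edge n)) → IsMatching es M → size M ≤ℕ m)

-- A deterministic online algorithm (for a fixed budget k): knowing the
-- vertex set Fin n, it maps the sequence of edges revealed so far to the
-- matching it outputs at the end of the current timestep.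
Algorithm : Set
Algorithm = (n : ℕ) → List (Edge n) → List (Edge n)

run : Algorithm → (n : ℕ) → List (Edge n) → ℕ → List (Edge n)
run A n es zero = []
run A n es (suc t) = A n (take (suc t) es)

Valid : ℕ → Algorithm → Set
Valid k A =
  ∀ (n : ℕ) (es : List (Edge n)) → SimpleGraph es →
  ∀ (t : ℕ) → t <ℕ length es →
    IsMatching (take (suc t) es) (run A n es (suc t))
    × reassignments (run A n es t) (run A n es (suc t)) ≤ℕ k
    × (∀ (x : Fin n) → Covered x (run A n es t) → Covered x (run A n es (suc t)))

ℕtoℚ : ℕ → ℚ
ℕtoℚ m = + m / 1

Competitive : ℕ → ℚ → Algorithm → Set
Competitive k ρ A =
  Valid k A ×
  Σ ℚ (λ c → (0ℚ ≤ c) ×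
    (∀ (n : ℕ) (es : List (Edge n)) → SimpleGraph es →
     ∀ (opt : ℕ) → IsOPT es opt →
       ρ * ℕtoℚ opt - c ≤ ℕtoℚ (size (run A n es (length es)))))

ratio : ℕ → ℚ → ℚ
ratio k ε = 1ℚ - (+ 2 / (2 +ℕ k)) + ε

-- Write k = 2m. The adversary reveals isolated edges; as the algorithm matches them, it chains m matched edges by
-- unmatched ones into a path and then hangs a fresh pendant vertex on each end. This gadget is an augmenting path on
-- 2m + 2 vertices with no further edges, so covering either end later would re-match all its vertices, exceeding the
-- budget, while matched vertices must stay matched: every gadget gives m edges to the algorithm and m + 1 to the
-- optimum. When no isolated edge is matched and no path is complete, the adversary adds a new isolated edge. At such
-- moments (m + 1) ALG ≤ m OPT + m, and since at most four steps pass per isolated edge created, they occur with OPT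
-- arbitrarily large, contradicting ALG ≥ (1 − 2/(k + 2) + ε) OPT − c = (m/(m + 1) + ε) OPT − c.

module Submission where

open import Defs

module Construction where

  open import Data.Bool using (Bool; true; false; T; _∧_; _xor_; if_then_else_)
  open import Data.Bool.Properties using (T-∧; T-∨)
  open import Data.Empty using (⊥; ⊥-elim)
  open import Data.Fin using (Fin; _≟_; zero; toℕ; fromℕ<)
  open import Data.Fin.Properties using (toℕ-fromℕ<)
  open import Data.List using (List; []; _∷_; _++_; [_]; length; reverse; map; concat; filterᵇ; head; last; take)
  open import Data.List.Properties
    using (∷-injective; take-all; concatMap-++; concat-++; ++-assoc; ++-identityʳ; reverse-involutive; reverse-++;
           unfold-reverse; length-++; length-reverse; length-map)
  open import Data.List.Membership.Propositional using (_∈_; _∉_; find; lose)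
  open import Data.List.Membership.Propositional.Properties
    using (∈-++⁺ˡ; ∈-++⁺ʳ; ∈-++⁻; ∈-filter⁺; ∈-concat⁺′; ∈-allFin; ∈-map⁺; ∈-map⁻)
  import Data.List.Membership.DecPropositional as DecMembership
  open import Data.List.Relation.Binary.Disjoint.Propositional using (Disjoint)
  open import Data.List.Relation.Binary.Permutation.Propositional
    using (_↭_; ↭-refl; ↭-prep; ↭-sym; ↭⇒↭ₛ; module PermutationReasoning)
  open import Data.List.Relation.Binary.Permutation.Propositional.Properties
    using (↭-reverse; ∈-resp-↭; shift; shifts; ++⁺ˡ; ++⁺ʳ)
  import Data.List.Relation.Binary.Permutation.Setoid.Properties as SetoidPermutation
  open import Data.List.Relation.Binary.Subset.Propositional using (_⊆_)
  open import Data.List.Relation.Unary.All using (All; []; _∷_; lookup; tabulate)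
  import Data.List.Relation.Unary.All as All
  import Data.List.Relation.Unary.All.Properties as All
  open import Data.List.Relation.Unary.AllPairs using ([]; _∷_)
  import Data.List.Relation.Unary.AllPairs.Properties as AllPairs
  open import Data.List.Relation.Unary.Any using (here; there)
  open import Data.List.Relation.Unary.Any.Properties using (any⁺; any⁻; reverse⁻)
  open import Data.List.Relation.Unary.Unique.Propositional using (Unique)
  import Data.List.Relation.Unary.Unique.Propositional as Unique
  import Data.List.Relation.Unary.Unique.Propositional.Properties as Unique
  open import Data.Maybe using (Maybe; just; nothing)
  open import Data.Nat using (ℕ; zero; suc; _≤_; _<_; z≤n; s≤s; _+_; _*_; _<?_) renaming (_≟_ to _≟ℕ_)
  open import Data.Nat.Properties
    using (≤-refl; ≤-reflexive; ≤-trans; ≤-pred; <-irrefl; <-≤-trans; <⇒≤; <⇒≱; ≮⇒≥; ≤∧≢⇒<; n≤1+n; n<1+n; m≤n⇒m≤1+n;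
           m≤m+n; m≤n+m; m≤n⇒∃[o]m+o≡n; +-assoc; +-comm; +-suc; +-identityʳ; +-mono-≤; +-monoˡ-≤; +-monoʳ-≤; +-mono-<;
           +-monoʳ-<; *-comm; *-zeroʳ; *-distribˡ-+; *-monoʳ-≤; module ≤-Reasoning)
  open import Data.Nat.Tactic.RingSolver using (solve-∀)
  open import Data.Product using (_×_; _,_; Σ; ∃-syntax; proj₁; proj₂; swap)
  open import Data.Sum using (_⊎_; inj₁; inj₂)
  open import Data.Unit using (⊤; tt)
  open import Function.Base using (_∘_)
  open import Function.Bundles using (Equivalence)
  open import Relation.Binary.PropositionalEquality
    using (_≡_; _≢_; refl; sym; trans; cong; cong₂; subst; setoid; module ≡-Reasoning)
  open import Relation.Nullary using (¬_; yes; no)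
  open import Relation.Nullary.Decidable using (⌊_⌋; T?; toWitness; fromWitness)

  module _ {A : Set} where

    Unique-resp-↭ : ∀ {xs ys : List A} → xs ↭ ys → Unique xs → Unique ys
    Unique-resp-↭ p = SetoidPermutation.Unique-resp-↭ (setoid A) (↭⇒↭ₛ p)

    Unique-reverse : ∀ {xs : List A} → Unique xs → Unique (reverse xs)
    Unique-reverse {xs} = Unique-resp-↭ (↭-sym (↭-reverse xs))

    ↭-middle : ∀ (xs ys zs ws : List A) → (xs ++ ys ++ zs) ++ ws ↭ (xs ++ zs) ++ ys ++ ws
    ↭-middle xs ys zs ws = begin
      (xs ++ ys ++ zs) ++ ws   ≡⟨ ++-assoc xs (ys ++ zs) ws ⟩
      xs ++ (ys ++ zs) ++ ws   ≡⟨ cong (xs ++_) (++-assoc ys zs ws) ⟩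
      xs ++ ys ++ zs ++ ws     ↭⟨ ++⁺ˡ xs (shifts ys zs) ⟩
      xs ++ zs ++ ys ++ ws     ≡⟨ ++-assoc xs zs (ys ++ ws) ⟨
      (xs ++ zs) ++ ys ++ ws   ∎
      where open PermutationReasoning

    length-∷ʳ : ∀ (xs : List A) x → length (xs ++ [ x ]) ≡ suc (length xs)
    length-∷ʳ xs x = trans (length-++ xs) (+-comm (length xs) 1)

    length-middle : ∀ (xs : List A) y ys → length (xs ++ y ∷ ys) ≡ length (xs ++ ys) + 1
    length-middle [] y ys = +-comm 1 (length ys)
    length-middle (_ ∷ xs) y ys = cong suc (length-middle xs y ys)

    All-reverse : ∀ {P : A → Set} {xs} → All P xs → All P (reverse xs)
    All-reverse pxs = tabulate (lookup pxs ∘ reverse⁻)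

    private
      remove : ∀ {x : A} {ys} → x ∈ ys → List A
      remove {ys = y ∷ ys} (here _) = ys
      remove {ys = y ∷ ys} (there p) = y ∷ remove p

      length-remove : ∀ {x : A} {ys} (p : x ∈ ys) → length ys ≡ suc (length (remove p))
      length-remove {ys = y ∷ ys} (here _) = refl
      length-remove {ys = y ∷ ys} (there p) = cong suc (length-remove p)

      ∈-remove : ∀ {x y : A} {ys} (p : x ∈ ys) → y ∈ ys → y ≢ x → y ∈ remove p
      ∈-remove (here refl) (here refl) y≢x = ⊥-elim (y≢x refl)
      ∈-remove (here refl) (there q) _ = q
      ∈-remove (there p) (here refl) _ = here refl
      ∈-remove (there p) (there q) y≢x = there (∈-remove p q y≢x)

    Unique⇒length≤ : ∀ {xs ys : List A} → Unique xs → xs ⊆ ys → length xs ≤ length ys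
    Unique⇒length≤ {[]} _ _ = z≤n
    Unique⇒length≤ {x ∷ xs} (x∉ ∷ u) xs⊆ys
      rewrite length-remove (xs⊆ys (here refl)) =
      s≤s (Unique⇒length≤ u (λ y∈xs → ∈-remove (xs⊆ys (here refl)) (xs⊆ys (there y∈xs)) (λ y≡x → lookup x∉ y∈xs (sym y≡x))))

    countB≡length-filterᵇ : ∀ (p : A → Bool) ys → countB p ys ≡ length (filterᵇ p ys)
    countB≡length-filterᵇ p [] = refl
    countB≡length-filterᵇ p (y ∷ ys) with p y
    ... | true = cong suc (countB≡length-filterᵇ p ys)
    ... | false = countB≡length-filterᵇ p ys

    Unique⇒length≤countB : ∀ (p : A → Bool) {xs ys} → Unique xs → xs ⊆ ys → All (λ x → T (p x)) xs → length xs ≤ countB p ys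
    Unique⇒length≤countB p {ys = ys} u xs⊆ys pxs rewrite countB≡length-filterᵇ p ys =
      Unique⇒length≤ u (λ x∈xs → ∈-filter⁺ (λ x → T? (p x)) (xs⊆ys x∈xs) (lookup pxs x∈xs))

    Unique-++⁻ˡ : ∀ {xs ys : List A} → Unique (xs ++ ys) → Unique xs
    Unique-++⁻ˡ {[]} _ = []
    Unique-++⁻ˡ {x ∷ xs} (x∉ ∷ u) = proj₁ (All.++⁻ xs x∉) ∷ Unique-++⁻ˡ u

    Unique-++⁻ʳ : ∀ {xs ys : List A} → Unique (xs ++ ys) → Unique ys
    Unique-++⁻ʳ {[]} u = u
    Unique-++⁻ʳ {x ∷ xs} (_ ∷ u) = Unique-++⁻ʳ {xs} u

    Unique-++-disjoint : ∀ {xs ys : List A} {z} → Unique (xs ++ ys) → z ∈ xs → z ∈ ys → ⊥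
    Unique-++-disjoint {x ∷ xs} (x∉ ∷ _) (here refl) z∈ys = lookup x∉ (∈-++⁺ʳ xs z∈ys) refl
    Unique-++-disjoint {x ∷ xs} (_ ∷ u) (there z∈xs) z∈ys = Unique-++-disjoint u z∈xs z∈ys

    Unique-split-injective : ∀ {p p' s s' : List A} {w} → Unique (p ++ w ∷ s) →
                             p ++ w ∷ s ≡ p' ++ w ∷ s' → p ≡ p' × s ≡ s'
    Unique-split-injective {[]} {[]} _ refl = refl , refl
    Unique-split-injective {[]} {x ∷ p'} (x∉ ∷ _) refl = ⊥-elim (lookup x∉ (∈-++⁺ʳ p' (here refl)) refl)
    Unique-split-injective {x ∷ p} {[]} (x∉ ∷ _) refl = ⊥-elim (lookup x∉ (∈-++⁺ʳ p (here refl)) refl)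
    Unique-split-injective {x ∷ p} {x' ∷ p'} (_ ∷ u) eq with ∷-injective eq
    ... | refl , eq' = let (p≡p' , s≡s') = Unique-split-injective {p} {p'} u eq' in cong (x ∷_) p≡p' , s≡s'

    Unique-concat⁻ : ∀ {xss : List (List A)} {xs} → Unique (concat xss) → xs ∈ xss → Unique xs
    Unique-concat⁻ {_ ∷ _} u (here refl) = Unique-++⁻ˡ u
    Unique-concat⁻ {xs ∷ _} u (there p) = Unique-concat⁻ (Unique-++⁻ʳ {xs} u) p

    Unique-concat-≡ : ∀ {xss : List (List A)} {xs ys w} → Unique (concat xss) → xs ∈ xss → ys ∈ xss → w ∈ xs → w ∈ ys → xs ≡ ys
    Unique-concat-≡ _ (here refl) (here refl) _ _ = refl
    Unique-concat-≡ {xs ∷ _} u (here refl) (there q) w∈xs w∈ys = ⊥-elim (Unique-++-disjoint {xs} u w∈xs (∈-concat⁺′ w∈ys q))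
    Unique-concat-≡ {ys ∷ _} u (there p) (here refl) w∈xs w∈ys = ⊥-elim (Unique-++-disjoint {ys} u w∈ys (∈-concat⁺′ w∈xs p))
    Unique-concat-≡ {xs ∷ _} u (there p) (there q) w∈xs w∈ys = Unique-concat-≡ (Unique-++⁻ʳ {xs} u) p q w∈xs w∈ys

    last-∷ʳ : ∀ (xs : List A) y → last (xs ++ [ y ]) ≡ just y
    last-∷ʳ [] y = refl
    last-∷ʳ (x ∷ []) y = refl
    last-∷ʳ (x ∷ x' ∷ xs) y = last-∷ʳ (x' ∷ xs) y

    Consecutive : List A → A → A → Set
    Consecutive c u v = Σ (List A) λ p → Σ (List A) λ s → c ≡ p ++ u ∷ v ∷ s

    Consecutive-∈ : ∀ {c : List A} {u v} → Consecutive c u v → u ∈ c × v ∈ c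
    Consecutive-∈ (p , _ , refl) = ∈-++⁺ʳ p (here refl) , ∈-++⁺ʳ p (there (here refl))

    Consecutive-∷ : ∀ {c : List A} {x u v} → Consecutive c u v → Consecutive (x ∷ c) u v
    Consecutive-∷ (p , s , refl) = _ ∷ p , s , refl

    Consecutive-++ : ∀ {c : List A} {r u v} → Consecutive c u v → Consecutive (c ++ r) u v
    Consecutive-++ {r = r} {u} {v} (p , s , refl) = p , s ++ r , ++-assoc p (u ∷ v ∷ s) r

    Consecutive-∷⁻ : ∀ {c : List A} {x u v} → Consecutive (x ∷ c) u v → (x ≡ u × head c ≡ just v) ⊎ Consecutive c u v
    Consecutive-∷⁻ ([] , _ , refl) = inj₁ (refl , refl)
    Consecutive-∷⁻ (_ ∷ p , s , refl) = inj₂ (p , s , refl)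

    Consecutive-[] : ∀ {u v : A} → ¬ Consecutive [] u v
    Consecutive-[] ([] , _ , ())
    Consecutive-[] (_ ∷ _ , _ , ())

    Consecutive-pair : ∀ {a b u v : A} → Consecutive (a ∷ b ∷ []) u v → u ≡ a × v ≡ b
    Consecutive-pair ([] , [] , refl) = refl , refl
    Consecutive-pair ([] , _ ∷ _ , ())
    Consecutive-pair (_ ∷ [] , _ , ())
    Consecutive-pair (_ ∷ _ ∷ [] , _ , ())
    Consecutive-pair (_ ∷ _ ∷ _ ∷ _ , _ , ())

    Consecutive-reverse⁺ : ∀ {c : List A} {u v} → Consecutive c u v → Consecutive (reverse c) v u
    Consecutive-reverse⁺ {u = u} {v} (p , s , refl) = reverse s , reverse p , (begin
      reverse (p ++ u ∷ v ∷ s)                 ≡⟨ reverse-++ p (u ∷ v ∷ s) ⟩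
      reverse (u ∷ v ∷ s) ++ reverse p         ≡⟨ cong (_++ reverse p) (unfold-reverse u (v ∷ s)) ⟩
      (reverse (v ∷ s) ++ [ u ]) ++ reverse p  ≡⟨ cong (λ z → (z ++ [ u ]) ++ reverse p) (unfold-reverse v s) ⟩
      ((reverse s ++ [ v ]) ++ [ u ]) ++ reverse p ≡⟨ ++-assoc (reverse s ++ [ v ]) [ u ] (reverse p) ⟩
      (reverse s ++ [ v ]) ++ u ∷ reverse p    ≡⟨ ++-assoc (reverse s) [ v ] (u ∷ reverse p) ⟩
      reverse s ++ v ∷ u ∷ reverse p           ∎)
      where open ≡-Reasoning

    Consecutive-reverse⁻ : ∀ {c : List A} {u v} → Consecutive (reverse c) u v → Consecutive c v u
    Consecutive-reverse⁻ {c} uv = subst (λ c' → Consecutive c' _ _) (reverse-involutive c) (Consecutive-reverse⁺ uv)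

    Linked : List A → A → A → Set
    Linked c u v = Consecutive c u v ⊎ Consecutive c v u

    Linked-sym : ∀ {c : List A} {u v} → Linked c u v → Linked c v u
    Linked-sym (inj₁ uv) = inj₂ uv
    Linked-sym (inj₂ vu) = inj₁ vu

    Linked-∈ : ∀ {c : List A} {u v} → Linked c u v → u ∈ c
    Linked-∈ (inj₁ uv) = proj₁ (Consecutive-∈ uv)
    Linked-∈ (inj₂ vu) = proj₂ (Consecutive-∈ vu)

    Linked-reverse : ∀ {c : List A} {u v} → Linked c u v → Linked (reverse c) u v
    Linked-reverse (inj₁ uv) = inj₂ (Consecutive-reverse⁺ uv)
    Linked-reverse (inj₂ vu) = inj₁ (Consecutive-reverse⁺ vu)

  -- Graphs given by edge lists, and their matchings

  module _ {n : ℕ} where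

    open DecMembership (_≟_ {n}) using (_∈?_)

    Adj : List (Edge n) → Fin n → Fin n → Set
    Adj es x y = (x , y) ∈ es ⊎ (y , x) ∈ es

    Adj-sym : ∀ {es x y} → Adj es x y → Adj es y x
    Adj-sym (inj₁ p) = inj₂ p
    Adj-sym (inj₂ p) = inj₁ p

    Adj-mono : ∀ {es es' x y} → es ⊆ es' → Adj es x y → Adj es' x y
    Adj-mono es⊆es' (inj₁ p) = inj₁ (es⊆es' p)
    Adj-mono es⊆es' (inj₂ p) = inj₂ (es⊆es' p)

    sameEdge-sound : ∀ {u v u' v' : Fin n} → T (sameEdge (u , v) (u' , v')) → (u ≡ u' × v ≡ v') ⊎ (u ≡ v' × v ≡ u')
    sameEdge-sound {u} {v} {u'} {v'} t with Equivalence.to T-∨ t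
    ... | inj₁ t₁ = let (p , q) = Equivalence.to T-∧ t₁ in inj₁ (toWitness {a? = u ≟ u'} p , toWitness {a? = v ≟ v'} q)
    ... | inj₂ t₂ = let (p , q) = Equivalence.to T-∧ t₂ in inj₂ (toWitness {a? = u ≟ v'} p , toWitness {a? = v ≟ u'} q)

    private
      T-∧⁺ : ∀ {a b} → T a → T b → T (a ∧ b)
      T-∧⁺ {a} {b} ta tb = Equivalence.from (T-∧ {a} {b}) (ta , tb)

      T-≟-refl : ∀ (u : Fin n) → T ⌊ u ≟ u ⌋
      T-≟-refl u = fromWitness {a? = u ≟ u} refl

    sameEdge-complete : ∀ {u v u' v' : Fin n} → (u ≡ u' × v ≡ v') ⊎ (u ≡ v' × v ≡ u') → T (sameEdge (u , v) (u' , v'))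
    sameEdge-complete {u} {v} (inj₁ (refl , refl)) =
      Equivalence.from (T-∨ {⌊ u ≟ u ⌋ ∧ ⌊ v ≟ v ⌋} {⌊ u ≟ v ⌋ ∧ ⌊ v ≟ u ⌋}) (inj₁ (T-∧⁺ (T-≟-refl u) (T-≟-refl v)))
    sameEdge-complete {u} {v} (inj₂ (refl , refl)) =
      Equivalence.from (T-∨ {⌊ u ≟ v ⌋ ∧ ⌊ v ≟ u ⌋} {⌊ u ≟ u ⌋ ∧ ⌊ v ≟ v ⌋}) (inj₂ (T-∧⁺ (T-≟-refl u) (T-≟-refl v)))

    memE⇒Adj : ∀ {x y} es → T (memE (x , y) es) → Adj es x y
    memE⇒Adj {x} {y} es t with find (any⁻ (sameEdge (x , y)) es t)
    ... | (u , v) , e∈es , same with sameEdge-sound {x} {y} {u} {v} same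
    ...   | inj₁ (refl , refl) = inj₁ e∈es
    ...   | inj₂ (refl , refl) = inj₂ e∈es

    Adj⇒memE : ∀ {x y es} → Adj es x y → T (memE (x , y) es)
    Adj⇒memE {x} {y} (inj₁ p) = any⁺ _ (lose p (sameEdge-complete {x} {y} (inj₁ (refl , refl))))
    Adj⇒memE {x} {y} (inj₂ p) = any⁺ _ (lose p (sameEdge-complete {x} {y} (inj₂ (refl , refl))))

    ∈⇒∈-endpoints : ∀ {M : List (Edge n)} {u v} → (u , v) ∈ M → u ∈ endpoints M × v ∈ endpoints M
    ∈⇒∈-endpoints {_ ∷ _} (here refl) = here refl , there (here refl)
    ∈⇒∈-endpoints {_ ∷ M} (there p) = let (u∈ , v∈) = ∈⇒∈-endpoints {M} p in there (there u∈) , there (there v∈)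

    Adj⇒Covered : ∀ {M : List (Edge n)} {x y} → Adj M x y → Covered x M
    Adj⇒Covered (inj₁ p) = proj₁ (∈⇒∈-endpoints p)
    Adj⇒Covered (inj₂ p) = proj₂ (∈⇒∈-endpoints p)

    Covered⇒Adj : ∀ {M : List (Edge n)} {x} → Covered x M → ∃[ y ] Adj M x y
    Covered⇒Adj {(_ , b) ∷ _} (here refl) = b , inj₁ (here refl)
    Covered⇒Adj {(a , _) ∷ _} (there (here refl)) = a , inj₂ (here refl)
    Covered⇒Adj {_ ∷ M} (there (there x∈)) = let (y , adj) = Covered⇒Adj {M} x∈ in y , Adj-mono there adj

    private
      Adj-∷⁻ : ∀ {M : List (Edge n)} {a b x y} → Adj ((a , b) ∷ M) x y → (x ≡ a × y ≡ b) ⊎ (x ≡ b × y ≡ a) ⊎ Adj M x y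
      Adj-∷⁻ (inj₁ (here refl)) = inj₁ (refl , refl)
      Adj-∷⁻ (inj₂ (here refl)) = inj₂ (inj₁ (refl , refl))
      Adj-∷⁻ (inj₁ (there p)) = inj₂ (inj₂ (inj₁ p))
      Adj-∷⁻ (inj₂ (there p)) = inj₂ (inj₂ (inj₂ p))

    Adj-functional : ∀ {M : List (Edge n)} {x y z} → Unique (endpoints M) → Adj M x y → Adj M x z → y ≡ z
    Adj-functional {[]} _ (inj₁ ()) _
    Adj-functional {[]} _ (inj₂ ()) _
    Adj-functional {(a , b) ∷ M} (a∉ ∷ b∉ ∷ u) p q with Adj-∷⁻ p | Adj-∷⁻ q
    ... | inj₁ (refl , refl) | inj₁ (refl , refl) = refl
    ... | inj₂ (inj₁ (refl , refl)) | inj₂ (inj₁ (refl , refl)) = refl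
    ... | inj₂ (inj₂ p') | inj₂ (inj₂ q') = Adj-functional u p' q'
    ... | inj₁ (refl , refl) | inj₂ (inj₁ (refl , _)) = ⊥-elim (lookup a∉ (here refl) refl)
    ... | inj₂ (inj₁ (refl , _)) | inj₁ (refl , refl) = ⊥-elim (lookup a∉ (here refl) refl)
    ... | inj₁ (refl , refl) | inj₂ (inj₂ q') = ⊥-elim (lookup a∉ (there (Adj⇒Covered q')) refl)
    ... | inj₂ (inj₂ p') | inj₁ (refl , refl) = ⊥-elim (lookup a∉ (there (Adj⇒Covered p')) refl)
    ... | inj₂ (inj₁ (refl , refl)) | inj₂ (inj₂ q') = ⊥-elim (lookup b∉ (Adj⇒Covered q') refl)
    ... | inj₂ (inj₂ p') | inj₂ (inj₁ (refl , refl)) = ⊥-elim (lookup b∉ (Adj⇒Covered p') refl)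

    IsMatching⇒Adj : ∀ {es M : List (Edge n)} {x y} → IsMatching es M → Adj M x y → Adj es x y
    IsMatching⇒Adj {es} (M⊆es , _) (inj₁ p) = memE⇒Adj es (lookup M⊆es p)
    IsMatching⇒Adj {es} (M⊆es , _) (inj₂ p) = Adj-sym (memE⇒Adj es (lookup M⊆es p))

    private
      T-xor⁺ : ∀ {b c} → ¬ T b → T c → T (b xor c)
      T-xor⁺ {false} _ tc = tc
      T-xor⁺ {true} ¬tb _ = ⊥-elim (¬tb tt)

      touching : ∀ {M M' : List (Edge n)} {w} e → e ∈ M' → T (incident w e) → ¬ T (memE e M) → T (touched M M' w)
      touching {M} {M'} {w} e e∈M' inc e∉M =
        any⁺ _ (lose (∈-++⁺ʳ M e∈M') (T-∧⁺ inc (T-xor⁺ e∉M (Adj⇒memE (inj₁ e∈M')))))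

      incident-fst : ∀ w v → T (incident w (w , v))
      incident-fst w v = Equivalence.from (T-∨ {⌊ w ≟ w ⌋} {⌊ w ≟ v ⌋}) (inj₁ (T-≟-refl w))

      incident-snd : ∀ u w → T (incident w (u , w))
      incident-snd u w = Equivalence.from (T-∨ {⌊ w ≟ u ⌋} {⌊ w ≟ w ⌋}) (inj₂ (T-≟-refl w))

    touched-new-partner : ∀ {M M' : List (Edge n)} {w w'} → Adj M' w w' → ¬ Adj M w w' → T (touched M M' w)
    touched-new-partner {M} {w = w} {w'} (inj₁ p) ¬adj = touching {M} {w = w} (w , w') p (incident-fst w w') (¬adj ∘ memE⇒Adj M)
    touched-new-partner {M} {w = w} {w'} (inj₂ p) ¬adj =
      touching {M} {w = w} (w' , w) p (incident-snd w' w) (¬adj ∘ Adj-sym ∘ memE⇒Adj M)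

    endpoints-++ : ∀ (ps qs : List (Edge n)) → endpoints (ps ++ qs) ≡ endpoints ps ++ endpoints qs
    endpoints-++ = concatMap-++ _

    length-endpoints : ∀ (ps : List (Edge n)) → length (endpoints ps) ≡ length ps + length ps
    length-endpoints [] = refl
    length-endpoints (_ ∷ ps) = cong suc (trans (cong suc (length-endpoints ps)) (sym (+-suc (length ps) (length ps))))

    reversePath : List (Edge n) → List (Edge n)
    reversePath ps = reverse (map swap ps)

    length-reversePath : ∀ ps → length (reversePath ps) ≡ length ps
    length-reversePath ps = trans (length-reverse (map swap ps)) (length-map swap ps)

    endpoints-reversePath : ∀ ps → endpoints (reversePath ps) ≡ reverse (endpoints ps)
    endpoints-reversePath [] = refl
    endpoints-reversePath ((a , b) ∷ ps) = begin
      endpoints (reversePath ((a , b) ∷ ps))           ≡⟨ cong endpoints (unfold-reverse (b , a) (map swap ps)) ⟩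
      endpoints (reversePath ps ++ [ (b , a) ])        ≡⟨ endpoints-++ (reversePath ps) [ (b , a) ] ⟩
      endpoints (reversePath ps) ++ b ∷ a ∷ []         ≡⟨ cong (_++ b ∷ a ∷ []) (endpoints-reversePath ps) ⟩
      reverse (endpoints ps) ++ b ∷ a ∷ []             ≡⟨ ++-assoc (reverse (endpoints ps)) [ b ] [ a ] ⟨
      (reverse (endpoints ps) ++ [ b ]) ++ [ a ]       ≡⟨ cong (_++ [ a ]) (unfold-reverse b (endpoints ps)) ⟨
      reverse (b ∷ endpoints ps) ++ [ a ]              ≡⟨ unfold-reverse a (b ∷ endpoints ps) ⟨
      reverse (a ∷ b ∷ endpoints ps)                   ∎
      where open ≡-Reasoning

    reverse-∷-endpoints : ∀ x ps → reverse (x ∷ endpoints ps) ≡ endpoints (reversePath ps) ++ [ x ]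
    reverse-∷-endpoints x ps = trans (unfold-reverse x (endpoints ps)) (cong (_++ [ x ]) (sym (endpoints-reversePath ps)))

    altPath : Fin n → List (Edge n) → Fin n → List (Fin n)
    altPath x ps y = x ∷ endpoints ps ++ [ y ]

    length-altPath : ∀ x ps y → length (altPath x ps y) ≡ suc (suc (length ps + length ps))
    length-altPath x ps y = cong suc (trans (length-∷ʳ (endpoints ps) y) (cong suc (length-endpoints ps)))

    reverse-altPath : ∀ x ps y → reverse (altPath x ps y) ≡ altPath y (reversePath ps) x
    reverse-altPath x ps y = begin
      reverse (x ∷ endpoints ps ++ [ y ])          ≡⟨ unfold-reverse x (endpoints ps ++ [ y ]) ⟩
      reverse (endpoints ps ++ [ y ]) ++ [ x ]     ≡⟨ cong (_++ [ x ]) (reverse-++ (endpoints ps) [ y ]) ⟩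
      y ∷ reverse (endpoints ps) ++ [ x ]          ≡⟨ cong (λ l → y ∷ l ++ [ x ]) (endpoints-reversePath ps) ⟨
      altPath y (reversePath ps) x                 ∎
      where open ≡-Reasoning

    PathComponent : List (Edge n) → Maybe (Fin n) → List (Fin n) → Set
    PathComponent es prev [] = ⊤
    PathComponent es prev (w ∷ ws) = (∀ y → Adj es w y → prev ≡ just y ⊎ head ws ≡ just y) × PathComponent es (just w) ws

    PathComponent-⊆ : ∀ {es es'} → es ⊆ es' → ∀ prev ws → PathComponent es' prev ws → PathComponent es prev ws
    PathComponent-⊆ _ prev [] _ = tt
    PathComponent-⊆ es⊆es' prev (w ∷ ws) (nbrs , rest) =
      (λ y adj → nbrs y (Adj-mono es⊆es' adj)) , PathComponent-⊆ es⊆es' (just w) ws rest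

    NeighboursLinked : List (Edge n) → List (Fin n) → Set
    NeighboursLinked es c = ∀ {w y} → w ∈ c → Adj es w y → Linked c w y

    NeighboursLinked-reverse : ∀ {es c} → NeighboursLinked es c → NeighboursLinked es (reverse c)
    NeighboursLinked-reverse linked w∈ adj = Linked-reverse (linked (reverse⁻ w∈) adj)

    private
      PathComponent-suffix : ∀ {es c} → Unique c → NeighboursLinked es c → ∀ pre ws → c ≡ pre ++ ws →
                             PathComponent es (last pre) ws
      PathComponent-suffix _ _ pre [] _ = tt
      PathComponent-suffix {es} {c} u linked pre (w ∷ ws) refl = nbrs , rest
        where
        nbrs : ∀ y → Adj es w y → last pre ≡ just y ⊎ head ws ≡ just y
        nbrs y adj with linked (∈-++⁺ʳ pre (here refl)) adj
        ... | inj₁ (p , s , eq) = inj₂ (cong head (proj₂ (Unique-split-injective {p = pre} {p' = p} u eq)))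
        ... | inj₂ (p , s , eq) = inj₁ (trans (cong last pre≡) (last-∷ʳ p y))
          where
          pre≡ : pre ≡ p ++ [ y ]
          pre≡ = proj₁ (Unique-split-injective {p = pre} {p' = p ++ [ y ]} u (trans eq (sym (++-assoc p [ y ] (w ∷ s)))))
        rest : PathComponent es (just w) ws
        rest = subst (λ z → PathComponent es z ws) (last-∷ʳ pre w)
          (PathComponent-suffix u linked (pre ++ [ w ]) ws (sym (++-assoc pre [ w ] ws)))

    PathComponent-fromLinked : ∀ {es c} → Unique c → NeighboursLinked es c → PathComponent es nothing c
    PathComponent-fromLinked {c = c} u linked = PathComponent-suffix u linked [] c refl

    data PairedUntilFree (M : List (Edge n)) : List (Fin n) → Set where
      [] : PairedUntilFree M []
      free : ∀ {w ws} → ¬ Covered w M → PairedUntilFree M (w ∷ ws)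
      pair : ∀ {w w' ws} → Adj M w w' → PairedUntilFree M ws → PairedUntilFree M (w ∷ w' ∷ ws)

    NotMatchedToFirst : List (Edge n) → Maybe (Fin n) → List (Fin n) → Set
    NotMatchedToFirst M (just p) (w ∷ _) = ¬ Adj M w p
    NotMatchedToFirst M _ _ = ⊤

    NotMatchedToFirst-free : ∀ {M p} ws → ¬ Covered p M → NotMatchedToFirst M (just p) ws
    NotMatchedToFirst-free [] _ = tt
    NotMatchedToFirst-free (w ∷ ws) p-free adj = p-free (Adj⇒Covered (Adj-sym adj))

    -- Walking along a path component, each covered vertex must be matched to the next one.
    pairedUntilFree : ∀ {es M} → IsMatching es M → ∀ prev ws → PathComponent es prev ws → Unique ws →
                      NotMatchedToFirst M prev ws → PairedUntilFree M ws
    pairedUntilFree _ prev [] _ _ _ = []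
    pairedUntilFree {M = M} mat prev (w ∷ ws) (nbrs , _) u not-prev with w ∈? endpoints M
    ... | no w-free = free w-free
    ... | yes w-covered with Covered⇒Adj {M} w-covered
    ...   | p , w~p with nbrs p (IsMatching⇒Adj mat w~p)
    pairedUntilFree mat (just p) (w ∷ ws) _ _ not-prev | yes _ | p , w~p | inj₁ refl = ⊥-elim (not-prev w~p)
    pairedUntilFree {M = M} mat prev (w ∷ w' ∷ ws) (_ , _ , comp) (w∉ ∷ _ ∷ u) _ | yes _ | _ , w~w' | inj₂ refl =
      pair w~w' (pairedUntilFree mat (just w') ws comp u (not-w' ws w∉))
      where
      not-w' : ∀ ws → All (w ≢_) (w' ∷ ws) → NotMatchedToFirst M (just w') ws
      not-w' [] _ = tt
      not-w' (w₂ ∷ _) (_ ∷ w≢w₂ ∷ _) w₂~w' = w≢w₂ (sym (Adj-functional (proj₂ mat) (Adj-sym w₂~w') (Adj-sym w~w')))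

    MatchedPairs : List (Edge n) → List (Edge n) → Set
    MatchedPairs M ps = All (λ e → Adj M (proj₁ e) (proj₂ e)) ps

    PairedUntilFree-prefix : ∀ {M} ps ws → PairedUntilFree M (endpoints ps ++ ws) → All (λ v → Covered v M) (endpoints ps) →
                             MatchedPairs M ps × PairedUntilFree M ws
    PairedUntilFree-prefix [] ws paired _ = [] , paired
    PairedUntilFree-prefix (_ ∷ ps) ws (free x-free) (x-covered ∷ _) = ⊥-elim (x-free x-covered)
    PairedUntilFree-prefix (_ ∷ ps) ws (pair x~y paired) (_ ∷ _ ∷ covered) =
      let (matched , rest) = PairedUntilFree-prefix ps ws paired covered in x~y ∷ matched , rest

    Shifted : List (Edge n) → Fin n → List (Edge n) → Fin n → Set
    Shifted M x [] y = Adj M x y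
    Shifted M x ((a , b) ∷ ps) y = Adj M x a × Shifted M b ps y

    PairedUntilFree⇒Shifted : ∀ {M} x ps y → PairedUntilFree M (altPath x ps y) → Covered x M →
                              All (λ v → Covered v M) (endpoints ps) → Shifted M x ps y
    PairedUntilFree⇒Shifted x [] y (free x-free) x-covered _ = ⊥-elim (x-free x-covered)
    PairedUntilFree⇒Shifted x [] y (pair x~y _) _ _ = x~y
    PairedUntilFree⇒Shifted x (_ ∷ ps) y (free x-free) x-covered _ = ⊥-elim (x-free x-covered)
    PairedUntilFree⇒Shifted x ((a , b) ∷ ps) y (pair x~a paired) _ (_ ∷ b-covered ∷ covered) =
      x~a , PairedUntilFree⇒Shifted b ps y paired b-covered covered

    Shifted⇒Covered : ∀ {M} x ps y → Shifted M x ps y → Covered y M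
    Shifted⇒Covered x [] y x~y = Adj⇒Covered (Adj-sym x~y)
    Shifted⇒Covered x ((a , b) ∷ ps) y (_ , shifted) = Shifted⇒Covered b ps y shifted

    Shifted-touched : ∀ {M M'} → Unique (endpoints M) → ∀ x ps y → Unique (altPath x ps y) →
                      Shifted M' x ps y → MatchedPairs M ps → (∀ z → Adj M x z → z ∉ endpoints ps ++ [ y ]) → ¬ Covered y M →
                      All (λ w → T (touched M M' w)) (altPath x ps y)
    Shifted-touched {M} unique x [] y _ x~y _ x-partner y-free =
      touched-new-partner {M} x~y (λ x~y₀ → x-partner y x~y₀ (here refl)) ∷
      touched-new-partner {M} (Adj-sym x~y) (λ y~x → y-free (Adj⇒Covered {M} y~x)) ∷ []
    Shifted-touched {M} unique x ((a , b) ∷ ps) y (x∉ ∷ a∉ ∷ u) (x~a , shifted) (a~b ∷ matched) x-partner y-free =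
      touched-new-partner {M} x~a (λ x~a₀ → x-partner a x~a₀ (here refl)) ∷
      touched-new-partner {M} (Adj-sym x~a) (λ a~x → lookup x∉ (there (here refl)) (sym (Adj-functional unique a~b a~x))) ∷
      Shifted-touched unique b ps y u shifted matched b-partner y-free
      where
      b-partner : ∀ z → Adj M b z → z ∉ endpoints ps ++ [ y ]
      b-partner z b~z z∈ with Adj-functional unique (Adj-sym a~b) b~z
      ... | refl = lookup a∉ (there z∈) refl

    -- Covering an end of the path from M' would shift all of it, touching every one of its vertices.
    altPath-ends-stay-free :
      ∀ {es es' M M'} → es ⊆ es' → IsMatching es M → IsMatching es' M' → (∀ {z} → Covered z M → Covered z M') →
      ∀ x ps y → Unique (altPath x ps y) →
      PathComponent es' nothing (altPath x ps y) → PathComponent es' nothing (altPath y (reversePath ps) x) →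
      All (λ v → Covered v M) (endpoints ps) → ¬ Covered x M → ¬ Covered y M →
      reassignments M M' < length (altPath x ps y) →
      ¬ Covered x M' × ¬ Covered y M'
    altPath-ends-stay-free {es} {es'} {M} {M'} es⊆es' mat mat' mono x ps y u comp comp-rev covered x-free y-free budget =
      x-free' , y-free'
      where
      covered' : All (λ v → Covered v M') (endpoints ps)
      covered' = All.map mono covered

      x-free' : ¬ Covered x M'
      x-free' x-covered = <⇒≱ budget (Unique⇒length≤countB (touched M M') u (λ {v} _ → ∈-allFin v) all-touched)
        where
        shifted : Shifted M' x ps y
        shifted = PairedUntilFree⇒Shifted x ps y (pairedUntilFree mat' nothing (altPath x ps y) comp u tt) x-covered covered'
        u-tail : Unique (endpoints ps ++ [ y ])
        u-tail = Unique.tail u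
        tail-paired : PairedUntilFree M (endpoints ps ++ [ y ])
        tail-paired = pairedUntilFree mat (just x) (endpoints ps ++ [ y ])
          (proj₂ (PathComponent-⊆ es⊆es' nothing (altPath x ps y) comp)) u-tail
          (NotMatchedToFirst-free (endpoints ps ++ [ y ]) x-free)
        all-touched : All (λ w → T (touched M M' w)) (altPath x ps y)
        all-touched = Shifted-touched (proj₂ mat) x ps y u shifted (proj₁ (PairedUntilFree-prefix ps [ y ] tail-paired covered))
          (λ z x~z _ → x-free (Adj⇒Covered x~z)) y-free

      y-free' : ¬ Covered y M'
      y-free' y-covered = x-free' (Shifted⇒Covered y (reversePath ps) x shifted)
        where
        u-rev : Unique (altPath y (reversePath ps) x)
        u-rev = subst Unique (reverse-altPath x ps y) (Unique-reverse u)
        covered-rev : All (λ v → Covered v M') (endpoints (reversePath ps))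
        covered-rev = subst (All _) (sym (endpoints-reversePath ps)) (All-reverse covered')
        shifted : Shifted M' y (reversePath ps) x
        shifted = PairedUntilFree⇒Shifted y (reversePath ps) x
          (pairedUntilFree mat' nothing (altPath y (reversePath ps) x) comp-rev u-rev tt) y-covered covered-rev

    end-of-matched-path-free : ∀ {es M} → IsMatching es M → ∀ x ps → Unique (x ∷ endpoints ps) →
      PathComponent es nothing (reverse (x ∷ endpoints ps)) → All (λ v → Covered v M) (endpoints ps) → ¬ Covered x M
    end-of-matched-path-free {es} {M} mat x ps u comp covered
      with PairedUntilFree-prefix (reversePath ps) [ x ] paired covered-rev
      where
      paired : PairedUntilFree M (endpoints (reversePath ps) ++ [ x ])
      paired = pairedUntilFree mat nothing _ (subst (PathComponent es nothing) (reverse-∷-endpoints x ps) comp)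
        (subst Unique (reverse-∷-endpoints x ps) (Unique-reverse u)) tt
      covered-rev : All (λ v → Covered v M) (endpoints (reversePath ps))
      covered-rev = subst (All _) (sym (endpoints-reversePath ps)) (All-reverse covered)
    ... | _ , free x-free = x-free

  m+m≤n+n⇒m≤n : ∀ {m n} → m + m ≤ n + n → m ≤ n
  m+m≤n+n⇒m≤n m+m≤n+n = ≮⇒≥ (λ n<m → <⇒≱ (+-mono-< n<m n<m) m+m≤n+n)

  time≤4created+1 : ∀ m T F p l L h → F ≡ p + l + suc m * L → T ≤ F + l + suc m * L + 2 * L + h → h ≤ 1 → T ≤ 4 * F + 1
  time≤4created+1 m T F p l L h F≡ T≤ h≤1 = begin
    T                                ≤⟨ T≤ ⟩
    F + l + suc m * L + 2 * L + h    ≡⟨ cong (λ x → x + 2 * L + h) (+-assoc F l (suc m * L)) ⟩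
    F + (l + suc m * L) + 2 * L + h  ≤⟨ +-mono-≤ (+-mono-≤ (+-monoʳ-≤ F l+mL≤F) (*-monoʳ-≤ 2 L≤F)) h≤1 ⟩
    F + F + 2 * F + 1                ≡⟨ four F ⟩
    4 * F + 1                        ∎
    where
    open ≤-Reasoning
    four : ∀ F → F + F + 2 * F + 1 ≡ 4 * F + 1
    four = solve-∀
    l+mL≤F : l + suc m * L ≤ F
    l+mL≤F = subst (l + suc m * L ≤_) (sym (trans F≡ (+-assoc p l _))) (m≤n+m _ p)
    L≤F : L ≤ F
    L≤F = ≤-trans (m≤m+n L (m * L)) (≤-trans (m≤n+m _ l) l+mL≤F)

  -- With m₀ = l + d, both sides differ by the polynomial (l + d) * p + 2 + 2 * d.
  ratio-bound : ∀ m₀ a p l L → a + a ≤ p + (l + l + L * (suc m₀ + suc m₀)) → l ≤ m₀ →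
                suc (suc m₀) * a ≤ suc m₀ * (p + (l + L * suc (suc m₀))) + suc m₀
  ratio-bound m₀ a p l L 2a≤ l≤m₀ with m≤n⇒∃[o]m+o≡n l≤m₀
  ... | d , refl = m+m≤n+n⇒m≤n (begin
    suc m * a + suc m * a                                            ≡⟨ *-distribˡ-+ (suc m) a a ⟨
    suc m * (a + a)                                                  ≤⟨ *-monoʳ-≤ (suc m) 2a≤ ⟩
    suc m * (p + (l + l + L * (m + m)))                              ≤⟨ m≤m+n _ ((l + d) * p + (2 + (d + d))) ⟩
    suc m * (p + (l + l + L * (m + m))) + ((l + d) * p + (2 + (d + d)))  ≡⟨ identity p l d L ⟩
    (m * (p + (l + L * suc m)) + m) + (m * (p + (l + L * suc m)) + m)  ∎)
    where
    open ≤-Reasoning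
    m = suc (l + d)
    identity : ∀ p l d L →
      suc (suc (l + d)) * (p + (l + l + L * (suc (l + d) + suc (l + d)))) + ((l + d) * p + (2 + (d + d)))
      ≡ (suc (l + d) * (p + (l + L * suc (suc (l + d)))) + suc (l + d))
        + (suc (l + d) * (p + (l + L * suc (suc (l + d)))) + suc (l + d))
    identity = solve-∀

  created≤optimum : ∀ m F p l L → F ≡ p + l + m * L → F ≤ p + (l + L * suc m)
  created≤optimum m F p l L F≡ = begin
    F                     ≡⟨ trans F≡ (+-assoc p l (m * L)) ⟩
    p + (l + m * L)       ≤⟨ +-monoʳ-≤ p (+-monoʳ-≤ l (≤-trans (≤-reflexive (*-comm m L)) (*-monoʳ-≤ L (n≤1+n m)))) ⟩
    p + (l + L * suc m)   ∎
    where open ≤-Reasoning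

  -- The adversary

  pick : ∀ {X : Set} → (X → Bool) → List X → Maybe (List X × X × List X)
  pick f [] = nothing
  pick f (x ∷ xs) with f x
  ... | true = just ([] , x , xs)
  ... | false with pick f xs
  ...   | nothing = nothing
  ...   | just (pre , y , post) = just (x ∷ pre , y , post)

  pick-just : ∀ {X : Set} (f : X → Bool) xs {pre y post} → pick f xs ≡ just (pre , y , post) → xs ≡ pre ++ y ∷ post × T (f y)
  pick-just f (x ∷ xs) eq with f x in fx
  ... | true with eq
  ...   | refl = refl , subst T (sym fx) tt
  pick-just f (x ∷ xs) eq | false with pick f xs in eq'
  ...   | just _ with eq
  ...     | refl = let (xs≡ , fy) = pick-just f xs eq' in cong (x ∷_) xs≡ , fy
  pick-just f (x ∷ xs) () | false | nothing

  pick-nothing : ∀ {X : Set} (f : X → Bool) xs → pick f xs ≡ nothing → All (λ x → ¬ T (f x)) xs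
  pick-nothing f [] _ = []
  pick-nothing f (x ∷ xs) eq with f x in fx
  pick-nothing f (x ∷ xs) () | true
  ... | false with pick f xs in eq'
  ...   | nothing = (λ t → subst T fx t) ∷ pick-nothing f xs eq'
  pick-nothing f (x ∷ xs) () | false | just _

  module Adversary (A : Algorithm) (m₀ N₀ : ℕ) where

    m : ℕ
    m = suc m₀

    N : ℕ
    N = suc N₀

    V : Set
    V = Fin N

    open DecMembership (_≟_ {N}) using (_∈?_)

    vertex : ℕ → V
    vertex i with i <? N
    ... | yes i<N = fromℕ< i<N
    ... | no _ = zero

    toℕ-vertex : ∀ {i} → i < N → toℕ (vertex i) ≡ i
    toℕ-vertex {i} i<N with i <? N
    ... | yes i<N' = toℕ-fromℕ< i<N'
    ... | no i≮N = ⊥-elim (i≮N i<N)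

    headOr : List V → V → V
    headOr [] d = d
    headOr (x ∷ _) _ = x

    -- A gadget (x , ps , y) is the path x , ps , y whose pairs ps the algorithm has matched.
    Gadget : Set
    Gadget = V × List (Edge N) × V

    record State : Set where
      constructor state
      field
        edges : List (Edge N)
        next : ℕ
        isolated : List (Edge N)
        path : List (Edge N)
        pendant : Maybe V
        gadgets : List Gadget
        created : ℕ
    open State

    edgeVertices : Edge N → List V
    edgeVertices e = proj₁ e ∷ proj₂ e ∷ []

    gadgetVertices : Gadget → List V
    gadgetVertices (x , ps , y) = altPath x ps y

    pathVertices : List (Edge N) → Maybe V → List V
    pathVertices ps nothing = endpoints ps
    pathVertices ps (just x) = x ∷ endpoints ps

    componentsOf : List (Edge N) → List (Edge N) → Maybe V → List Gadget → List (List V)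
    componentsOf pool ps h L = map edgeVertices pool ++ pathVertices ps h ∷ map gadgetVertices L

    components : State → List (List V)
    components (state _ _ pool ps h L _) = componentsOf pool ps h L

    isCovered : List (Edge N) → V → Bool
    isCovered M v = ⌊ v ∈? endpoints M ⌋

    bothCovered : List (Edge N) → Edge N → Bool
    bothCovered M (a , b) = isCovered M a ∧ isCovered M b

    promote : List (Edge N) → State → State
    promote M (state es u pool [] nothing L F) with pick (bothCovered M) pool
    ... | just (pre , e , post) = state es u (pre ++ post) [ e ] nothing L F
    ... | nothing = state es u pool [] nothing L F
    promote M S@(state _ _ _ (_ ∷ _) _ _ _) = S
    promote M S@(state _ _ _ [] (just _) _ _) = S

    createsIsolated : List (Edge N) → State → Bool
    createsIsolated M (state _ _ _ _ (just _) _ _) = false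
    createsIsolated M (state es u pool ps nothing L F) with length ps ≟ℕ m
    ... | yes _ = false
    ... | no _ with pick (bothCovered M) pool
    ...   | just _ = false
    ...   | nothing = true

    respond : List (Edge N) → State → State
    respond M (state es u pool ps (just x) L F) =
      state (es ++ [ (vertex u , headOr (endpoints (reversePath ps) ++ [ x ]) x) ]) (suc u)
            pool [] nothing ((vertex u , reversePath ps , x) ∷ L) F
    respond M (state es u pool ps nothing L F) with length ps ≟ℕ m
    ... | yes _ = state (es ++ [ (vertex u , headOr (endpoints ps) (vertex u)) ]) (suc u) pool ps (just (vertex u)) L F
    ... | no _ with pick (bothCovered M) pool
    ...   | just (pre , (a , b) , post) =
      state (es ++ [ (b , headOr (endpoints ps) b) ]) u (pre ++ post) ((a , b) ∷ ps) nothing L F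
    ...   | nothing =
      state (es ++ [ (vertex u , vertex (suc u)) ]) (suc (suc u)) ((vertex u , vertex (suc u)) ∷ pool) ps nothing L (suc F)

    stateAt : ℕ → State
    matchingAt : ℕ → List (Edge N)
    stateAt zero = state [] 0 [] [] nothing [] 0
    stateAt (suc t) = respond (matchingAt t) (promote (matchingAt t) (stateAt t))
    matchingAt t = run A N (edges (stateAt t)) t

    gadgetsVertices : List Gadget → List V
    gadgetsVertices L = concat (map gadgetVertices L)

    vertices : State → List V
    vertices (state _ _ pool ps h L _) = endpoints pool ++ pathVertices ps h ++ gadgetsVertices L

    vertices≡concat : ∀ S → vertices S ≡ concat (components S)
    vertices≡concat (state _ _ pool ps h L _) = concat-++ (map edgeVertices pool) (pathVertices ps h ∷ map gadgetVertices L)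

    record WellFormed (S : State) : Set where
      field
        distinct : Unique (vertices S)
        bounded : ∀ {v} → v ∈ vertices S → toℕ v < next S
        edge-linked : ∀ {e} → e ∈ edges S → Σ (List V) λ c → c ∈ components S × Linked c (proj₁ e) (proj₂ e)
        linked-edge : ∀ {c u v} → c ∈ components S → Consecutive c u v → Adj (edges S) u v

    module _ {S : State} (wf : WellFormed S) where
      open WellFormed wf

      distinct-concat : Unique (concat (components S))
      distinct-concat = subst Unique (vertices≡concat S) distinct

      Adj⇒Linked : ∀ {w y} → Adj (edges S) w y → Σ (List V) λ c → c ∈ components S × Linked c w y
      Adj⇒Linked (inj₁ p) = edge-linked p
      Adj⇒Linked (inj₂ p) = let (c , c∈ , linked) = edge-linked p in c , c∈ , Linked-sym linked

      Adj⇒∈vertices : ∀ {w y} → Adj (edges S) w y → w ∈ vertices S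
      Adj⇒∈vertices adj =
        let (c , c∈ , linked) = Adj⇒Linked adj in subst (_ ∈_) (sym (vertices≡concat S)) (∈-concat⁺′ (Linked-∈ linked) c∈)

      Covered⇒∈vertices : ∀ {M v} → IsMatching (edges S) M → Covered v M → v ∈ vertices S
      Covered⇒∈vertices mat v∈ = Adj⇒∈vertices (IsMatching⇒Adj mat (proj₂ (Covered⇒Adj v∈)))

      component-unique : ∀ {c} → c ∈ components S → Unique c
      component-unique = Unique-concat⁻ distinct-concat

      component-linked : ∀ {c} → c ∈ components S → NeighboursLinked (edges S) c
      component-linked c∈ w∈c adj with Adj⇒Linked adj
      ... | c' , c'∈ , linked = subst (λ z → Linked z _ _) (Unique-concat-≡ distinct-concat c'∈ c∈ (Linked-∈ linked) w∈c) linked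

      component-path : ∀ {c} → c ∈ components S → PathComponent (edges S) nothing c
      component-path c∈ = PathComponent-fromLinked (component-unique c∈) (component-linked c∈)

      component-path-reverse : ∀ {c} → c ∈ components S → PathComponent (edges S) nothing (reverse c)
      component-path-reverse c∈ =
        PathComponent-fromLinked (Unique-reverse (component-unique c∈)) (NeighboursLinked-reverse (component-linked c∈))

    record Extends (S S' : State) : Set where
      field
        new-edges : List (Edge N)
        fresh : List V
        edges≡ : edges S' ≡ edges S ++ new-edges
        vertices↭ : vertices S' ↭ fresh ++ vertices S
        fresh-distinct : Unique fresh
        fresh-bounds : All (λ v → next S ≤ toℕ v × toℕ v < next S') fresh
        next≤next : next S ≤ next S'
        new-linked : ∀ {e} → e ∈ new-edges → Σ (List V) λ c' → c' ∈ components S' × Linked c' (proj₁ e) (proj₂ e)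
        old-linked : ∀ {c u v} → c ∈ components S → Consecutive c u v → Σ (List V) λ c' → c' ∈ components S' × Linked c' u v
        consecutive-old-or-new : ∀ {c' u v} → c' ∈ components S' → Consecutive c' u v →
                                 (Σ (List V) λ c → c ∈ components S × Linked c u v) ⊎ Adj new-edges u v

    WellFormed-Extends : ∀ {S S'} → WellFormed S → Extends S S' → WellFormed S'
    WellFormed-Extends {S} {S'} wf ext = record
      { distinct = Unique-resp-↭ (↭-sym vertices↭) (Unique.++⁺ fresh-distinct distinct fresh-disjoint)
      ; bounded = bounded'
      ; edge-linked = edge-linked'
      ; linked-edge = linked-edge'
      }
      where
      open WellFormed wf
      open Extends ext

      fresh-disjoint : Disjoint fresh (vertices S)
      fresh-disjoint (v∈fresh , v∈S) = <⇒≱ (bounded v∈S) (proj₁ (lookup fresh-bounds v∈fresh))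

      bounded' : ∀ {v} → v ∈ vertices S' → toℕ v < next S'
      bounded' v∈ with ∈-++⁻ fresh (∈-resp-↭ vertices↭ v∈)
      ... | inj₁ v∈fresh = proj₂ (lookup fresh-bounds v∈fresh)
      ... | inj₂ v∈S = <-≤-trans (bounded v∈S) next≤next

      edge-linked' : ∀ {e} → e ∈ edges S' → Σ (List V) λ c → c ∈ components S' × Linked c (proj₁ e) (proj₂ e)
      edge-linked' e∈ with ∈-++⁻ (edges S) (subst (_ ∈_) edges≡ e∈)
      ... | inj₂ e∈new = new-linked e∈new
      ... | inj₁ e∈old with edge-linked e∈old
      ...   | c , c∈ , inj₁ uv = old-linked c∈ uv
      ...   | c , c∈ , inj₂ vu = let (c' , c'∈ , linked) = old-linked c∈ vu in c' , c'∈ , Linked-sym linked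

      linked-edge' : ∀ {c u v} → c ∈ components S' → Consecutive c u v → Adj (edges S') u v
      linked-edge' c'∈ uv = subst (λ es → Adj es _ _) (sym edges≡) (old-or-new (consecutive-old-or-new c'∈ uv))
        where
        old-or-new : ∀ {u v} → (Σ (List V) λ c → c ∈ components S × Linked c u v) ⊎ Adj new-edges u v →
                     Adj (edges S ++ new-edges) u v
        old-or-new (inj₁ (c , c∈ , inj₁ uv)) = Adj-mono ∈-++⁺ˡ (linked-edge c∈ uv)
        old-or-new (inj₁ (c , c∈ , inj₂ vu)) = Adj-mono ∈-++⁺ˡ (Adj-sym (linked-edge c∈ vu))
        old-or-new (inj₂ adj) = Adj-mono (∈-++⁺ʳ (edges S)) adj

    pendantCount : Maybe V → ℕ
    pendantCount nothing = 0
    pendantCount (just _) = 1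

    pendantCount≤1 : ∀ h → pendantCount h ≤ 1
    pendantCount≤1 nothing = z≤n
    pendantCount≤1 (just _) = ≤-refl

    Locked : List (Edge N) → Gadget → Set
    Locked M (x , ps , y) = All (λ v → Covered v M) (endpoints ps) × ¬ Covered x M × ¬ Covered y M

    Complete : Gadget → Set
    Complete (_ , ps , _) = length ps ≡ m

    record Invariant (t : ℕ) (S : State) (M : List (Edge N)) : Set where
      field
        length-edges : length (edges S) ≡ t
        simple : SimpleGraph (edges S)
        next≤ : next S ≤ t + t
        wellFormed : WellFormed S
        path≤m : length (path S) ≤ m
        pendant⇒complete : ∀ {x} → pendant S ≡ just x → length (path S) ≡ m
        gadgets-complete : All Complete (gadgets S)
        path-covered : All (λ v → Covered v M) (endpoints (path S))
        pendant-free : ∀ {x} → pendant S ≡ just x → ¬ Covered x M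
        gadgets-locked : All (Locked M) (gadgets S)
        matching : IsMatching (edges S) M
        created≡ : created S ≡ length (isolated S) + length (path S) + m * length (gadgets S)
        -- one step per created isolated edge, per edge joined to the path and per pendant vertex
        time≤ : t ≤ created S + length (path S) + m * length (gadgets S) + 2 * length (gadgets S) + pendantCount (pendant S)

    SimpleGraph-∷ʳ : ∀ {es : List (Edge N)} {a b} → SimpleGraph es → a ≢ b → ¬ Adj es a b → SimpleGraph (es ++ [ (a , b) ])
    SimpleGraph-∷ʳ {es} {a} {b} (loopless , distinct) a≢b ¬adj =
      All.++⁺ loopless (a≢b ∷ []) , AllPairs.++⁺ distinct ([] ∷ []) (tabulate (λ {f} f∈ → not-same f f∈ ∷ []))
      where
      not-same : ∀ f → f ∈ es → ¬ T (sameEdge f (a , b))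
      not-same (u , v) f∈ same with sameEdge-sound {u = u} {v} {a} {b} same
      ... | inj₁ (refl , refl) = ¬adj (inj₁ f∈)
      ... | inj₂ (refl , refl) = ¬adj (inj₂ f∈)

    complete-altPath-exceeds-budget : ∀ {r} (x : V) ps y → length ps ≡ m → r ≤ m * 2 → r < length (altPath x ps y)
    complete-altPath-exceeds-budget {r} x ps y ps≡m r≤2m = begin-strict
      r                                        ≤⟨ r≤2m ⟩
      m * 2                                    ≡⟨ *-comm m 2 ⟩
      m + (m + 0)                              ≡⟨ cong (m +_) (+-identityʳ m) ⟩
      m + m                                    <⟨ n≤1+n _ ⟩
      suc (suc (m + m))                        ≡⟨ cong (λ l → suc (suc (l + l))) ps≡m ⟨
      suc (suc (length ps + length ps))        ≡⟨ length-altPath x ps y ⟨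
      length (altPath x ps y)                  ∎
      where open ≤-Reasoning

    module _ {t S M} (I : Invariant t S M) {S' M'} (wf' : WellFormed S') (edges⊆ : edges S ⊆ edges S')
             (mat' : IsMatching (edges S') M') (mono : ∀ {z} → Covered z M → Covered z M')
             (budget : reassignments M M' ≤ m * 2) where
      open Invariant I

      gadget-stays-locked : ∀ g → gadgetVertices g ∈ components S' → Complete g → Locked M g → Locked M' g
      gadget-stays-locked (x , ps , y) g∈ complete (covered , x-free , y-free) =
        All.map mono covered ,
        altPath-ends-stay-free edges⊆ matching mat' mono x ps y (component-unique wf' g∈)
          (component-path wf' g∈)
          (subst (PathComponent (edges S') nothing) (reverse-altPath x ps y) (component-path-reverse wf' g∈))
          covered x-free y-free (complete-altPath-exceeds-budget x ps y complete budget)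

      gadgets-stay-locked : (∀ {g} → g ∈ gadgets S → gadgetVertices g ∈ components S') → All (Locked M') (gadgets S)
      gadgets-stay-locked gadgets⊆ =
        tabulate (λ {g} g∈ → gadget-stays-locked g (gadgets⊆ g∈) (lookup gadgets-complete g∈) (lookup gadgets-locked g∈))

    ∈-componentsOf⁻ : ∀ pool ps h L {c} → c ∈ componentsOf pool ps h L →
                      c ∈ map edgeVertices pool ⊎ c ≡ pathVertices ps h ⊎ c ∈ map gadgetVertices L
    ∈-componentsOf⁻ pool ps h L c∈ with ∈-++⁻ (map edgeVertices pool) c∈
    ... | inj₁ c∈pool = inj₁ c∈pool
    ... | inj₂ (here refl) = inj₂ (inj₁ refl)
    ... | inj₂ (there c∈L) = inj₂ (inj₂ c∈L)

    isolated∈componentsOf : ∀ {pool} ps h L {c} → c ∈ map edgeVertices pool → c ∈ componentsOf pool ps h L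
    isolated∈componentsOf _ _ _ = ∈-++⁺ˡ

    path∈componentsOf : ∀ pool ps h L → pathVertices ps h ∈ componentsOf pool ps h L
    path∈componentsOf pool _ _ _ = ∈-++⁺ʳ (map edgeVertices pool) (here refl)

    gadget∈componentsOf : ∀ pool ps h {L c} → c ∈ map gadgetVertices L → c ∈ componentsOf pool ps h L
    gadget∈componentsOf pool _ _ c∈L = ∈-++⁺ʳ (map edgeVertices pool) (there c∈L)

    ∈-map-middle⁻ : ∀ {X : Set} (f : Edge N → X) pre e post {c} → c ∈ map f (pre ++ e ∷ post) →
                    c ≡ f e ⊎ c ∈ map f (pre ++ post)
    ∈-map-middle⁻ f pre e post c∈ with ∈-map⁻ f c∈
    ... | d , d∈ , refl with ∈-++⁻ pre d∈
    ...   | inj₁ d∈pre = inj₂ (∈-map⁺ f (∈-++⁺ˡ d∈pre))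
    ...   | inj₂ (here refl) = inj₁ refl
    ...   | inj₂ (there d∈post) = inj₂ (∈-map⁺ f (∈-++⁺ʳ pre d∈post))

    ∈-map-middle⁺ : ∀ {X : Set} (f : Edge N → X) pre e post {c} → c ∈ map f (pre ++ post) → c ∈ map f (pre ++ e ∷ post)
    ∈-map-middle⁺ f pre e post c∈ with ∈-map⁻ f c∈
    ... | d , d∈ , refl with ∈-++⁻ pre d∈
    ...   | inj₁ d∈pre = ∈-map⁺ f (∈-++⁺ˡ d∈pre)
    ...   | inj₂ d∈post = ∈-map⁺ f (∈-++⁺ʳ pre (there d∈post))

    isolated-to-path-↭ : ∀ pre e post rest →
                         endpoints (pre ++ post) ++ edgeVertices e ++ rest ↭ endpoints (pre ++ e ∷ post) ++ rest
    isolated-to-path-↭ pre e post rest = begin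
      endpoints (pre ++ post) ++ edgeVertices e ++ rest
        ≡⟨ cong (_++ edgeVertices e ++ rest) (endpoints-++ pre post) ⟩
      (endpoints pre ++ endpoints post) ++ edgeVertices e ++ rest
        ↭⟨ ↭-middle (endpoints pre) (edgeVertices e) (endpoints post) rest ⟨
      (endpoints pre ++ edgeVertices e ++ endpoints post) ++ rest
        ≡⟨ cong (_++ rest) (endpoints-++ pre (e ∷ post)) ⟨
      endpoints (pre ++ e ∷ post) ++ rest
        ∎
      where open PermutationReasoning

    bothCovered⇒Covered : ∀ {M} e → T (bothCovered M e) → Covered (proj₁ e) M × Covered (proj₂ e) M
    bothCovered⇒Covered {M} (a , b) t =
      let (ta , tb) = Equivalence.to (T-∧ {isCovered M a} {isCovered M b}) t
      in toWitness {a? = a ∈? endpoints M} ta , toWitness {a? = b ∈? endpoints M} tb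

    Promoted : List (Edge N) → State → Set
    Promoted M S = path S ≡ [] → pendant S ≡ nothing → pick (bothCovered M) (isolated S) ≡ nothing

    promote-Extends : ∀ {es u L F} pre e post →
      Extends (state es u (pre ++ e ∷ post) [] nothing L F) (state es u (pre ++ post) [ e ] nothing L F)
    promote-Extends {es} {u} {L} {F} pre e post = record
      { new-edges = []
      ; fresh = []
      ; edges≡ = sym (++-identityʳ es)
      ; vertices↭ = isolated-to-path-↭ pre e post (gadgetsVertices L)
      ; fresh-distinct = []
      ; fresh-bounds = []
      ; next≤next = ≤-refl
      ; new-linked = λ ()
      ; old-linked = old-linked
      ; consecutive-old-or-new = consecutive-old-or-new
      }
      where
      old-linked : ∀ {c u v} → c ∈ componentsOf (pre ++ e ∷ post) [] nothing L → Consecutive c u v →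
                   Σ (List V) λ c' → c' ∈ componentsOf (pre ++ post) [ e ] nothing L × Linked c' u v
      old-linked c∈ uv with ∈-componentsOf⁻ (pre ++ e ∷ post) [] nothing L c∈
      ... | inj₂ (inj₁ refl) = ⊥-elim (Consecutive-[] uv)
      ... | inj₂ (inj₂ c∈L) = _ , gadget∈componentsOf (pre ++ post) [ e ] nothing c∈L , inj₁ uv
      ... | inj₁ c∈pool with ∈-map-middle⁻ edgeVertices pre e post c∈pool
      ...   | inj₁ refl = _ , path∈componentsOf (pre ++ post) [ e ] nothing L , inj₁ uv
      ...   | inj₂ c∈pool' = _ , isolated∈componentsOf [ e ] nothing L c∈pool' , inj₁ uv
      consecutive-old-or-new : ∀ {c' u v} → c' ∈ componentsOf (pre ++ post) [ e ] nothing L → Consecutive c' u v →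
                               (Σ (List V) λ c → c ∈ componentsOf (pre ++ e ∷ post) [] nothing L × Linked c u v) ⊎ Adj [] u v
      consecutive-old-or-new c'∈ uv with ∈-componentsOf⁻ (pre ++ post) [ e ] nothing L c'∈
      ... | inj₁ c∈pool = inj₁ (_ , isolated∈componentsOf [] nothing L (∈-map-middle⁺ edgeVertices pre e post c∈pool) , inj₁ uv)
      ... | inj₂ (inj₁ refl) =
        inj₁ (_ , isolated∈componentsOf [] nothing L (∈-map⁺ edgeVertices (∈-++⁺ʳ pre (here refl))) , inj₁ uv)
      ... | inj₂ (inj₂ c∈L) = inj₁ (_ , gadget∈componentsOf (pre ++ e ∷ post) [] nothing c∈L , inj₁ uv)

    promote-Invariant : ∀ {t es u L F M} pre e post → T (bothCovered M e) →
      Invariant t (state es u (pre ++ e ∷ post) [] nothing L F) M → Invariant t (state es u (pre ++ post) [ e ] nothing L F) M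
    promote-Invariant {t} {es} {u} {L} {F} {M} pre e post e-covered I = record
      { length-edges = length-edges ; simple = simple ; next≤ = next≤
      ; wellFormed = WellFormed-Extends wellFormed (promote-Extends pre e post)
      ; path≤m = s≤s z≤n ; pendant⇒complete = λ () ; gadgets-complete = gadgets-complete
      ; path-covered = let (a-covered , b-covered) = bothCovered⇒Covered {M} e e-covered in a-covered ∷ b-covered ∷ []
      ; pendant-free = λ () ; gadgets-locked = gadgets-locked ; matching = matching
      ; created≡ = trans created≡ (cong (_+ m * length L) (trans (+-identityʳ _) (length-middle pre e post)))
      ; time≤ = ≤-trans time≤ (+-monoˡ-≤ 0 (+-monoˡ-≤ (2 * length L) (+-monoˡ-≤ (m * length L) (+-monoʳ-≤ F z≤n))))
      }
      where
      open Invariant I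

    promote-invariant : ∀ {t S M} → Invariant t S M → Invariant t (promote M S) M
    promote-invariant {t} {state es u pool [] nothing L F} {M} I with pick (bothCovered M) pool in eq
    ... | nothing = I
    ... | just (pre , e , post) =
      let (pool≡ , e-covered) = pick-just (bothCovered M) pool eq
      in promote-Invariant pre e post e-covered (subst (λ pool → Invariant t (state es u pool [] nothing L F) M) pool≡ I)
    promote-invariant {S = state _ _ _ (_ ∷ _) _ _ _} I = I
    promote-invariant {S = state _ _ _ [] (just _) _ _} I = I

    promote-Promoted : ∀ M S → Promoted M (promote M S)
    promote-Promoted M (state es u pool [] nothing L F) with pick (bothCovered M) pool in eq
    ... | nothing = λ _ _ → eq
    ... | just _ = λ ()
    promote-Promoted M (state _ _ _ (_ ∷ _) _ _ _) = λ ()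
    promote-Promoted M (state _ _ _ [] (just _) _ _) = λ _ ()

    created-promote : ∀ M S → created (promote M S) ≡ created S
    created-promote M (state es u pool [] nothing L F) with pick (bothCovered M) pool
    ... | nothing = refl
    ... | just _ = refl
    created-promote M (state _ _ _ (_ ∷ _) _ _ _) = refl
    created-promote M (state _ _ _ [] (just _) _ _) = refl

    edges-promote : ∀ M S → edges (promote M S) ≡ edges S
    edges-promote M (state es u pool [] nothing L F) with pick (bothCovered M) pool
    ... | nothing = refl
    ... | just _ = refl
    edges-promote M (state _ _ _ (_ ∷ _) _ _ _) = refl
    edges-promote M (state _ _ _ [] (just _) _ _) = refl

    -- Step t + 1 uses at most two fresh vertices, numbered below 2t + 2.
    Room : ℕ → Set
    Room t = suc (suc (t + t)) ≤ N

    NextInvariant : ℕ → List (Edge N) → State → Set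
    NextInvariant t M S' = ∀ {M'} → IsMatching (edges S') M' → reassignments M M' ≤ m * 2 →
                           (∀ {z} → Covered z M → Covered z M') →
                           Invariant (suc t) S' M'

    fresh∉vertices : ∀ {S} → WellFormed S → ∀ {v} → next S ≤ toℕ v → v ∉ vertices S
    fresh∉vertices wf next≤v v∈ = <⇒≱ (WellFormed.bounded wf v∈) next≤v

    module _ {t S M} (I : Invariant t S M) (room : Room t) where
      open Invariant I

      toℕ-vertex-next : toℕ (vertex (next S)) ≡ next S
      toℕ-vertex-next = toℕ-vertex (≤-trans (s≤s (m≤n⇒m≤1+n next≤)) room)

      toℕ-vertex-next+1 : toℕ (vertex (suc (next S))) ≡ suc (next S)
      toℕ-vertex-next+1 = toℕ-vertex (≤-trans (s≤s (s≤s next≤)) room)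

      next-fresh : vertex (next S) ∉ vertices S
      next-fresh = fresh∉vertices wellFormed (≤-reflexive (sym toℕ-vertex-next))

    module NewIsolated {t es u pool ps L F M} (I : Invariant t (state es u pool ps nothing L F) M) (room : Room t) where
      open Invariant I

      S = state es u pool ps nothing L F
      x = vertex u
      y = vertex (suc u)
      S' = state (es ++ [ (x , y) ]) (suc (suc u)) ((x , y) ∷ pool) ps nothing L (suc F)

      x-index : toℕ x ≡ u
      x-index = toℕ-vertex-next I room

      y-index : toℕ y ≡ suc u
      y-index = toℕ-vertex-next+1 I room

      x-fresh : x ∉ vertices S
      x-fresh = next-fresh I room

      y-fresh : y ∉ vertices S
      y-fresh = fresh∉vertices wellFormed (≤-trans (n≤1+n u) (≤-reflexive (sym y-index)))

      x≢y : x ≢ y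
      x≢y x≡y = <-irrefl (trans (sym x-index) (trans (cong toℕ x≡y) y-index)) (n<1+n u)

      consecutive-old-or-new : ∀ {c' u v} → c' ∈ components S' → Consecutive c' u v →
                               (Σ (List V) λ c → c ∈ components S × Linked c u v) ⊎ Adj [ (x , y) ] u v
      consecutive-old-or-new (here refl) uv with Consecutive-pair uv
      ... | refl , refl = inj₂ (inj₁ (here refl))
      consecutive-old-or-new (there c∈) uv = inj₁ (_ , c∈ , inj₁ uv)

      extends : Extends S S'
      extends = record
        { new-edges = [ (x , y) ]
        ; fresh = x ∷ y ∷ []
        ; edges≡ = refl
        ; vertices↭ = ↭-refl
        ; fresh-distinct = (x≢y ∷ []) ∷ [] ∷ []
        ; fresh-bounds = (≤-reflexive (sym x-index) , m≤n⇒m≤1+n (≤-reflexive (cong suc x-index)))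
                       ∷ (≤-trans (n≤1+n u) (≤-reflexive (sym y-index)) , ≤-reflexive (cong suc y-index))
                       ∷ []
        ; next≤next = ≤-trans (n≤1+n u) (n≤1+n (suc u))
        ; new-linked = λ { (here refl) → _ , here refl , inj₁ ([] , [] , refl) }
        ; old-linked = λ c∈ uv → _ , there c∈ , inj₁ uv
        ; consecutive-old-or-new = consecutive-old-or-new
        }

      simple' : SimpleGraph (edges S')
      simple' = SimpleGraph-∷ʳ simple x≢y (x-fresh ∘ Adj⇒∈vertices wellFormed)

      invariant' : NextInvariant t M S'
      invariant' mat' budget mono = record
        { length-edges = trans (length-∷ʳ es _) (cong suc length-edges)
        ; simple = simple'
        ; next≤ = ≤-trans (s≤s (s≤s next≤)) (≤-reflexive (sym (cong suc (+-suc t t))))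
        ; wellFormed = wf'
        ; path≤m = path≤m ; pendant⇒complete = λ () ; gadgets-complete = gadgets-complete
        ; path-covered = All.map mono path-covered
        ; pendant-free = λ ()
        ; gadgets-locked =
            gadgets-stay-locked I wf' ∈-++⁺ˡ mat' mono budget
              (there ∘ gadget∈componentsOf pool ps nothing ∘ ∈-map⁺ gadgetVertices)
        ; matching = mat'
        ; created≡ = cong suc created≡
        ; time≤ = s≤s time≤
        }
        where
        wf' = WellFormed-Extends wellFormed extends

    module AttachPendant {t es u pool a b ps' L F M} (I : Invariant t (state es u pool ((a , b) ∷ ps') nothing L F) M)
                         (room : Room t) (complete : length ((a , b) ∷ ps') ≡ m) where
      open Invariant I

      ps = (a , b) ∷ ps'
      S = state es u pool ps nothing L F
      x = vertex u
      S' = state (es ++ [ (x , a) ]) (suc u) pool ps (just x) L F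

      x-fresh : x ∉ vertices S
      x-fresh = next-fresh I room

      a∈vertices : a ∈ vertices S
      a∈vertices = ∈-++⁺ʳ (endpoints pool) (here refl)

      old-linked : ∀ {c u v} → c ∈ components S → Consecutive c u v → Σ (List V) λ c' → c' ∈ components S' × Linked c' u v
      old-linked c∈ uv with ∈-componentsOf⁻ pool ps nothing L c∈
      ... | inj₁ c∈pool = _ , isolated∈componentsOf ps (just x) L c∈pool , inj₁ uv
      ... | inj₂ (inj₁ refl) = _ , path∈componentsOf pool ps (just x) L , inj₁ (Consecutive-∷ uv)
      ... | inj₂ (inj₂ c∈L) = _ , gadget∈componentsOf pool ps (just x) c∈L , inj₁ uv

      consecutive-old-or-new : ∀ {c' u v} → c' ∈ components S' → Consecutive c' u v →
                               (Σ (List V) λ c → c ∈ components S × Linked c u v) ⊎ Adj [ (x , a) ] u v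
      consecutive-old-or-new c'∈ uv with ∈-componentsOf⁻ pool ps (just x) L c'∈
      ... | inj₁ c∈pool = inj₁ (_ , isolated∈componentsOf ps nothing L c∈pool , inj₁ uv)
      ... | inj₂ (inj₂ c∈L) = inj₁ (_ , gadget∈componentsOf pool ps nothing c∈L , inj₁ uv)
      ... | inj₂ (inj₁ refl) with Consecutive-∷⁻ uv
      ...   | inj₁ (refl , refl) = inj₂ (inj₁ (here refl))
      ...   | inj₂ uv' = inj₁ (_ , path∈componentsOf pool ps nothing L , inj₁ uv')

      extends : Extends S S'
      extends = record
        { new-edges = [ (x , a) ]
        ; fresh = [ x ]
        ; edges≡ = refl
        ; vertices↭ = shift x (endpoints pool) (endpoints ps ++ gadgetsVertices L)
        ; fresh-distinct = [] ∷ []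
        ; fresh-bounds = (≤-reflexive (sym (toℕ-vertex-next I room)) , ≤-reflexive (cong suc (toℕ-vertex-next I room))) ∷ []
        ; next≤next = n≤1+n u
        ; new-linked = λ { (here refl) → _ , path∈componentsOf pool ps (just x) L , inj₁ ([] , b ∷ endpoints ps' , refl) }
        ; old-linked = old-linked
        ; consecutive-old-or-new = consecutive-old-or-new
        }

      simple' : SimpleGraph (edges S')
      simple' =
        SimpleGraph-∷ʳ simple (λ x≡a → x-fresh (subst (_∈ vertices S) (sym x≡a) a∈vertices))
                              (x-fresh ∘ Adj⇒∈vertices wellFormed)

      invariant' : NextInvariant t M S'
      invariant' mat' budget mono = record
        { length-edges = trans (length-∷ʳ es _) (cong suc length-edges)
        ; simple = simple'
        ; next≤ = ≤-trans (s≤s (m≤n⇒m≤1+n next≤)) (≤-reflexive (sym (cong suc (+-suc t t))))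
        ; wellFormed = wf'
        ; path≤m = path≤m ; pendant⇒complete = λ _ → complete ; gadgets-complete = gadgets-complete
        ; path-covered = All.map mono path-covered
        ; pendant-free = λ { refl → end-of-matched-path-free mat' x ps (component-unique wf' path∈)
                                       (component-path-reverse wf' path∈)
                                       (All.map mono path-covered) }
        ; gadgets-locked =
            gadgets-stay-locked I wf' ∈-++⁺ˡ mat' mono budget (gadget∈componentsOf pool ps (just x) ∘ ∈-map⁺ gadgetVertices)
        ; matching = mat'
        ; created≡ = created≡
        ; time≤ = ≤-trans (s≤s (≤-trans time≤ (≤-reflexive (+-identityʳ _)))) (≤-reflexive (+-comm 1 _))
        }
        where
        wf' = WellFormed-Extends wellFormed extends
        path∈ = path∈componentsOf pool ps (just x) L

    private
      created-extend : ∀ X P Q → X + 1 + P + Q ≡ X + suc P + Q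
      created-extend = solve-∀

      time-extend : ∀ F P Q R → suc (F + P + Q + R + 0) ≡ F + suc P + Q + R + 0
      time-extend = solve-∀

    module ExtendPath {t es u pre a b post c d ps' L F M}
                      (I : Invariant t (state es u (pre ++ (a , b) ∷ post) ((c , d) ∷ ps') nothing L F) M)
                      (ab-covered : T (bothCovered M (a , b))) (incomplete : length ((c , d) ∷ ps') ≢ m) where
      open Invariant I

      ps = (c , d) ∷ ps'
      pool = pre ++ (a , b) ∷ post
      S = state es u pool ps nothing L F
      S' = state (es ++ [ (b , c) ]) u (pre ++ post) ((a , b) ∷ ps) nothing L F

      ab∈isolated : edgeVertices (a , b) ∈ map edgeVertices pool
      ab∈isolated = ∈-map⁺ edgeVertices (∈-++⁺ʳ pre (here refl))

      ab-component : edgeVertices (a , b) ∈ components S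
      ab-component = isolated∈componentsOf ps nothing L ab∈isolated

      isolated-not-path : ∀ {v} → v ∈ edgeVertices (a , b) → v ∉ endpoints ps ++ gadgetsVertices L
      isolated-not-path v∈ab v∈ps =
        Unique-++-disjoint {xs = endpoints pool} (WellFormed.distinct wellFormed) (∈-concat⁺′ v∈ab ab∈isolated) v∈ps

      path' = path∈componentsOf (pre ++ post) ((a , b) ∷ ps) nothing L

      old-linked : ∀ {c u v} → c ∈ components S → Consecutive c u v → Σ (List V) λ c' → c' ∈ components S' × Linked c' u v
      old-linked c∈ uv with ∈-componentsOf⁻ pool ps nothing L c∈
      ... | inj₂ (inj₁ refl) = _ , path' , inj₁ (Consecutive-∷ (Consecutive-∷ uv))
      ... | inj₂ (inj₂ c∈L) = _ , gadget∈componentsOf (pre ++ post) ((a , b) ∷ ps) nothing c∈L , inj₁ uv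
      ... | inj₁ c∈pool with ∈-map-middle⁻ edgeVertices pre (a , b) post c∈pool
      ...   | inj₁ refl = _ , path' , inj₁ (Consecutive-++ uv)
      ...   | inj₂ c∈pool' = _ , isolated∈componentsOf ((a , b) ∷ ps) nothing L c∈pool' , inj₁ uv

      consecutive-old-or-new : ∀ {c' u v} → c' ∈ components S' → Consecutive c' u v →
                               (Σ (List V) λ c → c ∈ components S × Linked c u v) ⊎ Adj [ (b , c) ] u v
      consecutive-old-or-new c'∈ uv with ∈-componentsOf⁻ (pre ++ post) ((a , b) ∷ ps) nothing L c'∈
      ... | inj₁ c∈pool =
        inj₁ (_ , isolated∈componentsOf ps nothing L (∈-map-middle⁺ edgeVertices pre (a , b) post c∈pool) , inj₁ uv)
      ... | inj₂ (inj₂ c∈L) = inj₁ (_ , gadget∈componentsOf pool ps nothing c∈L , inj₁ uv)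
      ... | inj₂ (inj₁ refl) with Consecutive-∷⁻ uv
      ...   | inj₁ (refl , refl) = inj₁ (_ , ab-component , inj₁ ([] , [] , refl))
      ...   | inj₂ uv' with Consecutive-∷⁻ uv'
      ...     | inj₁ (refl , refl) = inj₂ (inj₁ (here refl))
      ...     | inj₂ uv'' = inj₁ (_ , path∈componentsOf pool ps nothing L , inj₁ uv'')

      extends : Extends S S'
      extends = record
        { new-edges = [ (b , c) ]
        ; fresh = []
        ; edges≡ = refl
        ; vertices↭ = isolated-to-path-↭ pre (a , b) post (endpoints ps ++ gadgetsVertices L)
        ; fresh-distinct = []
        ; fresh-bounds = []
        ; next≤next = ≤-refl
        ; new-linked = λ { (here refl) → _ , path' , inj₁ (a ∷ [] , d ∷ endpoints ps' , refl) }
        ; old-linked = old-linked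
        ; consecutive-old-or-new = consecutive-old-or-new
        }

      simple' : SimpleGraph (edges S')
      simple' = SimpleGraph-∷ʳ simple (λ b≡c → isolated-not-path (there (here refl)) (subst (_∈ _) (sym b≡c) (here refl))) ¬b~c
        where
        ¬b~c : ¬ Adj es b c
        ¬b~c b~c = isolated-not-path (Linked-∈ (Linked-sym (component-linked wellFormed ab-component (there (here refl)) b~c)))
                                     (here refl)

      invariant' : NextInvariant t M S'
      invariant' mat' budget mono = record
        { length-edges = trans (length-∷ʳ es _) (cong suc length-edges)
        ; simple = simple'
        ; next≤ = ≤-trans next≤ (≤-trans (n≤1+n _) (≤-trans (n≤1+n _) (≤-reflexive (sym (cong suc (+-suc t t))))))
        ; wellFormed = wf'
        ; path≤m = ≤∧≢⇒< path≤m incomplete ; pendant⇒complete = λ () ; gadgets-complete = gadgets-complete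
        ; path-covered = let (a-covered , b-covered) = bothCovered⇒Covered {M} (a , b) ab-covered
                         in mono a-covered ∷ mono b-covered ∷ All.map mono path-covered
        ; pendant-free = λ ()
        ; gadgets-locked = gadgets-stay-locked I wf' ∈-++⁺ˡ mat' mono budget
                             (gadget∈componentsOf (pre ++ post) ((a , b) ∷ ps) nothing ∘ ∈-map⁺ gadgetVertices)
        ; matching = mat'
        ; created≡ = trans created≡ (trans (cong (λ l → l + length ps + m * length L) (length-middle pre (a , b) post))
                                           (created-extend (length (pre ++ post)) (length ps) (m * length L)))
        ; time≤ = subst (suc t ≤_) (time-extend F (length ps) (m * length L) (2 * length L)) (s≤s time≤)
        }
        where
        wf' = WellFormed-Extends wellFormed extends

    private
      created-close : ∀ P m L → P + m + m * L ≡ P + 0 + m * suc L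
      created-close = solve-∀

      time-close : ∀ F m L → suc (F + m + m * L + 2 * L + 1) ≡ F + 0 + m * suc L + 2 * suc L + 0
      time-close = solve-∀

      Consecutive-headOr : ∀ y (l : List V) x → Consecutive (y ∷ l ++ [ x ]) y (headOr (l ++ [ x ]) x)
      Consecutive-headOr y [] x = [] , [] , refl
      Consecutive-headOr y (z ∷ l) x = [] , l ++ [ x ] , refl

      head≡headOr : ∀ (l : List V) x → head (l ++ [ x ]) ≡ just (headOr (l ++ [ x ]) x)
      head≡headOr [] x = refl
      head≡headOr (_ ∷ _) x = refl

      headOr-∈ : ∀ (l : List V) x → headOr (l ++ [ x ]) x ∈ l ++ [ x ]
      headOr-∈ [] x = here refl
      headOr-∈ (_ ∷ _) x = here refl

    module CloseGadget {t es u pool ps x L F M} (I : Invariant t (state es u pool ps (just x) L F) M) (room : Room t) where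
      open Invariant I

      S = state es u pool ps (just x) L F
      y = vertex u
      qs = reversePath ps
      l = endpoints qs ++ [ x ]
      z = headOr l x
      GL = gadgetsVertices L
      S' = state (es ++ [ (y , z) ]) (suc u) pool [] nothing ((y , qs , x) ∷ L) F

      l≡ : l ≡ reverse (x ∷ endpoints ps)
      l≡ = sym (reverse-∷-endpoints x ps)

      y-fresh : y ∉ vertices S
      y-fresh = next-fresh I room

      path⇒gadget : ∀ {u v} → Consecutive (x ∷ endpoints ps) u v → Consecutive (altPath y qs x) v u
      path⇒gadget uv = Consecutive-∷ (subst (λ c → Consecutive c _ _) (sym l≡) (Consecutive-reverse⁺ uv))

      gadget⇒path : ∀ {u v} → Consecutive l u v → Consecutive (x ∷ endpoints ps) v u
      gadget⇒path uv = Consecutive-reverse⁻ (subst (λ c → Consecutive c _ _) l≡ uv)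

      gadget∈ : altPath y qs x ∈ components S'
      gadget∈ = gadget∈componentsOf pool [] nothing {(y , qs , x) ∷ L} (here refl)

      z∈vertices : z ∈ vertices S
      z∈vertices = ∈-++⁺ʳ (endpoints pool) (∈-++⁺ˡ {ys = gadgetsVertices L} (reverse⁻ z∈reverse))
        where
        z∈reverse : z ∈ reverse (x ∷ endpoints ps)
        z∈reverse = subst (z ∈_) l≡ (headOr-∈ (endpoints qs) x)

      vertices↭ : vertices S' ↭ y ∷ vertices S
      vertices↭ = begin
        endpoints pool ++ y ∷ l ++ GL
          ↭⟨ shift y (endpoints pool) (l ++ GL) ⟩
        y ∷ endpoints pool ++ l ++ GL
          ≡⟨ cong (λ l' → y ∷ endpoints pool ++ l' ++ GL) l≡ ⟩
        y ∷ endpoints pool ++ reverse (x ∷ endpoints ps) ++ GL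
          ↭⟨ ↭-prep y (++⁺ˡ (endpoints pool) (++⁺ʳ GL (↭-reverse (x ∷ endpoints ps)))) ⟩
        y ∷ endpoints pool ++ (x ∷ endpoints ps) ++ GL
          ∎
        where open PermutationReasoning

      old-linked : ∀ {c u v} → c ∈ components S → Consecutive c u v → Σ (List V) λ c' → c' ∈ components S' × Linked c' u v
      old-linked c∈ uv with ∈-componentsOf⁻ pool ps (just x) L c∈
      ... | inj₁ c∈pool = _ , isolated∈componentsOf [] nothing ((y , qs , x) ∷ L) c∈pool , inj₁ uv
      ... | inj₂ (inj₂ c∈L) = _ , gadget∈componentsOf pool [] nothing {(y , qs , x) ∷ L} (there c∈L) , inj₁ uv
      ... | inj₂ (inj₁ refl) = _ , gadget∈ , inj₂ (path⇒gadget uv)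

      consecutive-old-or-new : ∀ {c' u v} → c' ∈ components S' → Consecutive c' u v →
                               (Σ (List V) λ c → c ∈ components S × Linked c u v) ⊎ Adj [ (y , z) ] u v
      consecutive-old-or-new c'∈ uv with ∈-componentsOf⁻ pool [] nothing ((y , qs , x) ∷ L) c'∈
      ... | inj₁ c∈pool = inj₁ (_ , isolated∈componentsOf ps (just x) L c∈pool , inj₁ uv)
      ... | inj₂ (inj₁ refl) = ⊥-elim (Consecutive-[] uv)
      ... | inj₂ (inj₂ (there c∈L)) = inj₁ (_ , gadget∈componentsOf pool ps (just x) c∈L , inj₁ uv)
      ... | inj₂ (inj₂ (here refl)) with Consecutive-∷⁻ uv
      ...   | inj₁ (refl , head≡) with trans (sym head≡) (head≡headOr (endpoints qs) x)
      ...     | refl = inj₂ (inj₁ (here refl))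
      consecutive-old-or-new c'∈ uv | inj₂ (inj₂ (here refl)) | inj₂ uv' =
        inj₁ (_ , path∈componentsOf pool ps (just x) L , inj₂ (gadget⇒path uv'))

      extends : Extends S S'
      extends = record
        { new-edges = [ (y , z) ]
        ; fresh = [ y ]
        ; edges≡ = refl
        ; vertices↭ = vertices↭
        ; fresh-distinct = [] ∷ []
        ; fresh-bounds = (≤-reflexive (sym (toℕ-vertex-next I room)) , ≤-reflexive (cong suc (toℕ-vertex-next I room))) ∷ []
        ; next≤next = n≤1+n u
        ; new-linked = λ { (here refl) → _ , gadget∈ , inj₁ (Consecutive-headOr y (endpoints qs) x) }
        ; old-linked = old-linked
        ; consecutive-old-or-new = consecutive-old-or-new
        }

      simple' : SimpleGraph (edges S')
      simple' =
        SimpleGraph-∷ʳ simple (λ y≡z → y-fresh (subst (_∈ vertices S) (sym y≡z) z∈vertices))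
                              (y-fresh ∘ Adj⇒∈vertices wellFormed)

      invariant' : NextInvariant t M S'
      invariant' mat' budget mono = record
        { length-edges = trans (length-∷ʳ es _) (cong suc length-edges)
        ; simple = simple'
        ; next≤ = ≤-trans (s≤s (m≤n⇒m≤1+n next≤)) (≤-reflexive (sym (cong suc (+-suc t t))))
        ; wellFormed = wf'
        ; path≤m = z≤n ; pendant⇒complete = λ () ; gadgets-complete = qs-complete ∷ gadgets-complete
        ; path-covered = []
        ; pendant-free = λ ()
        ; gadgets-locked = gadget-stays-locked I wf' ∈-++⁺ˡ mat' mono budget (y , qs , x) gadget∈ qs-complete
                             (qs-covered , (y-fresh ∘ Covered⇒∈vertices wellFormed matching) , pendant-free refl)
                         ∷ gadgets-stay-locked I wf' ∈-++⁺ˡ mat' mono budget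
                             (gadget∈componentsOf pool [] nothing {(y , qs , x) ∷ L} ∘ there ∘ ∈-map⁺ gadgetVertices)
        ; matching = mat'
        ; created≡ = trans created≡ (trans (cong (λ l → length pool + l + m * length L) (pendant⇒complete refl))
                                           (created-close (length pool) m (length L)))
        ; time≤ = subst (suc t ≤_) (trans (cong (λ l → suc (F + l + m * length L + 2 * length L + 1)) (pendant⇒complete refl))
                                          (time-close F m (length L))) (s≤s time≤)
        }
        where
        wf' = WellFormed-Extends wellFormed extends
        qs-complete : length qs ≡ m
        qs-complete = trans (length-reversePath ps) (pendant⇒complete refl)
        qs-covered : All (λ v → Covered v M) (endpoints qs)
        qs-covered = subst (All _) (sym (endpoints-reversePath ps)) (All-reverse path-covered)

    respond-invariant : ∀ {t S M} → Invariant t S M → Promoted M S → Room t →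
                        SimpleGraph (edges (respond M S)) × NextInvariant t M (respond M S)
    respond-invariant {S = state _ _ _ _ (just _) _ _} I _ room = CloseGadget.simple' I room , CloseGadget.invariant' I room
    respond-invariant {S = state _ _ pool [] nothing _ _} {M} I promoted room with pick (bothCovered M) pool in eq
    ... | nothing = NewIsolated.simple' I room , NewIsolated.invariant' I room
    ... | just _ with () ← promoted refl refl
    respond-invariant {S = state _ _ pool ps@(_ ∷ _) nothing _ _} {M} I promoted room with length ps ≟ℕ m
    ... | yes complete = AttachPendant.simple' I room complete , AttachPendant.invariant' I room complete
    ... | no incomplete with pick (bothCovered M) pool in eq
    ...   | nothing = NewIsolated.simple' I room , NewIsolated.invariant' I room
    ...   | just (pre , (a , b) , post) with pick-just (bothCovered M) pool eq
    ...     | refl , ab-covered = ExtendPath.simple' I ab-covered incomplete , ExtendPath.invariant' I ab-covered incomplete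

    created-respond : ∀ M S → created (respond M S) ≡ created S + (if createsIsolated M S then 1 else 0)
    created-respond M (state _ _ _ _ (just _) _ F) = sym (+-identityʳ F)
    created-respond M (state es u pool ps nothing L F) with length ps ≟ℕ m
    ... | yes _ = sym (+-identityʳ F)
    ... | no _ with pick (bothCovered M) pool
    ...   | just _ = sym (+-identityʳ F)
    ...   | nothing = +-comm 1 F

    Stable : List (Edge N) → State → Set
    Stable M S = pendant S ≡ nothing × length (path S) ≢ m × pick (bothCovered M) (isolated S) ≡ nothing

    createsIsolated⇒Stable : ∀ M S → createsIsolated M S ≡ true → Stable M S
    createsIsolated⇒Stable M (state _ _ _ _ (just _) _ _) ()
    createsIsolated⇒Stable M (state es u pool ps nothing L F) creates with length ps ≟ℕ m
    createsIsolated⇒Stable M (state es u pool ps nothing L F) () | yes _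
    ... | no incomplete with pick (bothCovered M) pool in eq
    ...   | nothing = refl , incomplete , refl
    createsIsolated⇒Stable M (state es u pool ps nothing L F) () | no _ | just _

    shifted : V → List (Edge N) → V → List (Edge N)
    shifted x [] y = [ (x , y) ]
    shifted x ((a , b) ∷ ps) y = (x , a) ∷ shifted b ps y

    endpoints-shifted : ∀ x ps y → endpoints (shifted x ps y) ≡ altPath x ps y
    endpoints-shifted x [] y = refl
    endpoints-shifted x ((a , b) ∷ ps) y = cong (λ l → x ∷ a ∷ l) (endpoints-shifted b ps y)

    length-shifted : ∀ x ps y → length (shifted x ps y) ≡ suc (length ps)
    length-shifted x [] y = refl
    length-shifted x ((a , b) ∷ ps) y = cong suc (length-shifted b ps y)

    ∈-shifted⇒Consecutive : ∀ {x ps y u v} → (u , v) ∈ shifted x ps y → Consecutive (altPath x ps y) u v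
    ∈-shifted⇒Consecutive {ps = []} (here refl) = [] , [] , refl
    ∈-shifted⇒Consecutive {ps = (a , b) ∷ ps} {y} (here refl) = [] , b ∷ endpoints ps ++ [ y ] , refl
    ∈-shifted⇒Consecutive {ps = (a , b) ∷ ps} (there uv∈) = Consecutive-∷ (Consecutive-∷ (∈-shifted⇒Consecutive {ps = ps} uv∈))

    ∈⇒Consecutive-endpoints : ∀ {ps : List (Edge N)} {u v} → (u , v) ∈ ps → Consecutive (endpoints ps) u v
    ∈⇒Consecutive-endpoints {(a , b) ∷ ps} (here refl) = [] , endpoints ps , refl
    ∈⇒Consecutive-endpoints {_ ∷ ps} (there uv∈) = Consecutive-∷ (Consecutive-∷ (∈⇒Consecutive-endpoints {ps} uv∈))

    gadgetsMatching : List Gadget → List (Edge N)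
    gadgetsMatching [] = []
    gadgetsMatching ((x , ps , y) ∷ L) = shifted x ps y ++ gadgetsMatching L

    endpoints-gadgetsMatching : ∀ L → endpoints (gadgetsMatching L) ≡ gadgetsVertices L
    endpoints-gadgetsMatching [] = refl
    endpoints-gadgetsMatching ((x , ps , y) ∷ L) =
      trans (endpoints-++ (shifted x ps y) (gadgetsMatching L))
            (cong₂ _++_ (endpoints-shifted x ps y) (endpoints-gadgetsMatching L))

    length-gadgetsMatching : ∀ L → All Complete L → length (gadgetsMatching L) ≡ length L * suc m
    length-gadgetsMatching [] [] = refl
    length-gadgetsMatching ((x , ps , y) ∷ L) (complete ∷ completes) =
      trans (length-++ (shifted x ps y))
            (cong₂ _+_ (trans (length-shifted x ps y) (cong suc complete)) (length-gadgetsMatching L completes))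

    ∈-gadgetsMatching⁻ : ∀ {L u v} → (u , v) ∈ gadgetsMatching L → Σ Gadget λ g → g ∈ L × Consecutive (gadgetVertices g) u v
    ∈-gadgetsMatching⁻ {(x , ps , y) ∷ L} uv∈ with ∈-++⁻ (shifted x ps y) uv∈
    ... | inj₁ uv∈shifted = _ , here refl , ∈-shifted⇒Consecutive {ps = ps} uv∈shifted
    ... | inj₂ uv∈L = let (g , g∈ , uv) = ∈-gadgetsMatching⁻ {L} uv∈L in g , there g∈ , uv

    coveredEnds : List (Edge N) → List (Edge N) → List V
    coveredEnds M [] = []
    coveredEnds M ((a , b) ∷ pool) = (if isCovered M a then a else b) ∷ coveredEnds M pool

    gadgetsInterior : List Gadget → List V
    gadgetsInterior [] = []
    gadgetsInterior ((_ , ps , _) ∷ L) = endpoints ps ++ gadgetsInterior L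

    length-coveredEnds : ∀ M pool → length (coveredEnds M pool) ≡ length pool
    length-coveredEnds M [] = refl
    length-coveredEnds M (_ ∷ pool) = cong suc (length-coveredEnds M pool)

    length-gadgetsInterior : ∀ L → All Complete L → length (gadgetsInterior L) ≡ length L * (m + m)
    length-gadgetsInterior [] [] = refl
    length-gadgetsInterior ((_ , ps , _) ∷ L) (complete ∷ completes) =
      trans (length-++ (endpoints ps))
            (cong₂ _+_ (trans (length-endpoints ps) (cong₂ _+_ complete complete)) (length-gadgetsInterior L completes))

    ∈-coveredEnds : ∀ {M} pool → All (λ e → ¬ T (bothCovered M e)) pool → ∀ {v} → v ∈ endpoints pool → Covered v M →
                    v ∈ coveredEnds M pool
    ∈-coveredEnds {M} ((a , b) ∷ pool) (_ ∷ _) (here refl) a-covered with isCovered M a in covered?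
    ... | true = here refl
    ... | false = ⊥-elim (subst T covered? (fromWitness {a? = a ∈? endpoints M} a-covered))
    ∈-coveredEnds {M} ((a , b) ∷ pool) (¬both ∷ _) (there (here refl)) b-covered with isCovered M a
    ... | true = ⊥-elim (¬both (fromWitness {a? = b ∈? endpoints M} b-covered))
    ... | false = here refl
    ∈-coveredEnds {M} (_ ∷ pool) (_ ∷ ¬boths) (there (there v∈)) v-covered = there (∈-coveredEnds pool ¬boths v∈ v-covered)

    ∈-gadgetsInterior : ∀ {M} L → All (Locked M) L → ∀ {v} → v ∈ gadgetsVertices L → Covered v M → v ∈ gadgetsInterior L
    ∈-gadgetsInterior {M} ((x , ps , y) ∷ L) ((_ , x-free , y-free) ∷ lockeds) v∈ v-covered with ∈-++⁻ (altPath x ps y) v∈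
    ... | inj₂ v∈L = ∈-++⁺ʳ (endpoints ps) (∈-gadgetsInterior {M} L lockeds v∈L v-covered)
    ... | inj₁ (here refl) = ⊥-elim (x-free v-covered)
    ... | inj₁ (there v∈path) with ∈-++⁻ (endpoints ps) v∈path
    ...   | inj₁ v∈ps = ∈-++⁺ˡ v∈ps
    ...   | inj₂ (here refl) = ⊥-elim (y-free v-covered)

    module StableState {s es u pool ps L F M} (I : Invariant s (state es u pool ps nothing L F) M)
                       (unmatched : All (λ e → ¬ T (bothCovered M e)) pool) where
      open Invariant I

      S = state es u pool ps nothing L F

      alg-bound : length M + length M ≤ length pool + (length ps + length ps + length L * (m + m))
      alg-bound = begin
        length M + length M                                  ≡⟨ length-endpoints M ⟨
        length (endpoints M)                                 ≤⟨ Unique⇒length≤ (proj₂ matching) M⊆ ⟩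
        length (coveredEnds M pool ++ endpoints ps ++ gadgetsInterior L)
          ≡⟨ length-++ (coveredEnds M pool) ⟩
        length (coveredEnds M pool) + length (endpoints ps ++ gadgetsInterior L)
          ≡⟨ cong₂ _+_ (length-coveredEnds M pool)
                       (trans (length-++ (endpoints ps))
                              (cong₂ _+_ (length-endpoints ps) (length-gadgetsInterior L gadgets-complete))) ⟩
        length pool + (length ps + length ps + length L * (m + m)) ∎
        where
        open ≤-Reasoning
        M⊆ : endpoints M ⊆ coveredEnds M pool ++ endpoints ps ++ gadgetsInterior L
        M⊆ {v} v-covered with ∈-++⁻ (endpoints pool) (Covered⇒∈vertices wellFormed matching v-covered)
        ... | inj₁ v∈pool = ∈-++⁺ˡ (∈-coveredEnds {M} pool unmatched v∈pool v-covered)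
        ... | inj₂ v∈rest with ∈-++⁻ (endpoints ps) v∈rest
        ...   | inj₁ v∈ps = ∈-++⁺ʳ (coveredEnds M pool) (∈-++⁺ˡ v∈ps)
        ...   | inj₂ v∈L =
          ∈-++⁺ʳ (coveredEnds M pool) (∈-++⁺ʳ (endpoints ps) (∈-gadgetsInterior {M} L gadgets-locked v∈L v-covered))

      optimum : List (Edge N)
      optimum = pool ++ ps ++ gadgetsMatching L

      endpoints-optimum : endpoints optimum ≡ vertices S
      endpoints-optimum =
        trans (endpoints-++ pool (ps ++ gadgetsMatching L))
              (cong (endpoints pool ++_) (trans (endpoints-++ ps (gadgetsMatching L))
                                                (cong (endpoints ps ++_) (endpoints-gadgetsMatching L))))

      optimum-matching : IsMatching es optimum
      optimum-matching =
        tabulate (λ {e} e∈ → in-graph e e∈) , subst Unique (sym endpoints-optimum) (WellFormed.distinct wellFormed)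
        where
        linked-edge = WellFormed.linked-edge wellFormed
        in-graph : ∀ e → e ∈ optimum → T (memE e es)
        in-graph (a , b) e∈ with ∈-++⁻ pool e∈
        ... | inj₁ e∈pool =
          Adj⇒memE (linked-edge (isolated∈componentsOf ps nothing L (∈-map⁺ edgeVertices e∈pool)) ([] , [] , refl))
        ... | inj₂ e∈rest with ∈-++⁻ ps e∈rest
        ...   | inj₁ e∈ps = Adj⇒memE (linked-edge (path∈componentsOf pool ps nothing L) (∈⇒Consecutive-endpoints e∈ps))
        ...   | inj₂ e∈L = let (g , g∈ , ab) = ∈-gadgetsMatching⁻ {L} e∈L
                           in Adj⇒memE (linked-edge (gadget∈componentsOf pool ps nothing (∈-map⁺ gadgetVertices g∈)) ab)

      optimum-maximum : ∀ M' → IsMatching es M' → length M' ≤ length optimum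
      optimum-maximum M' mat' = m+m≤n+n⇒m≤n (begin
        length M' + length M'                   ≡⟨ length-endpoints M' ⟨
        length (endpoints M')                   ≤⟨ Unique⇒length≤ (proj₂ mat') M'⊆optimum ⟩
        length (endpoints optimum)              ≡⟨ length-endpoints optimum ⟩
        length optimum + length optimum         ∎)
        where
        open ≤-Reasoning
        M'⊆optimum : endpoints M' ⊆ endpoints optimum
        M'⊆optimum = subst (_ ∈_) (sym endpoints-optimum) ∘ Covered⇒∈vertices wellFormed mat'

      optimum-IsOPT : IsOPT es (length optimum)
      optimum-IsOPT = (optimum , optimum-matching , refl) , optimum-maximum

      length-optimum : length optimum ≡ length pool + (length ps + length L * suc m)
      length-optimum =
        trans (length-++ pool)
              (cong (length pool +_) (trans (length-++ ps) (cong (length ps +_) (length-gadgetsMatching L gadgets-complete))))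

    edges-respond : ∀ M S → Σ (Edge N) λ e → edges (respond M S) ≡ edges S ++ [ e ]
    edges-respond M (state _ _ _ _ (just _) _ _) = _ , refl
    edges-respond M (state es u pool ps nothing L F) with length ps ≟ℕ m
    ... | yes _ = _ , refl
    ... | no _ with pick (bothCovered M) pool
    ...   | just (_ , (_ , _) , _) = _ , refl
    ...   | nothing = _ , refl

    edges-stateAt : ∀ t → Σ (Edge N) λ e → edges (stateAt (suc t)) ≡ edges (stateAt t) ++ [ e ]
    edges-stateAt t with edges-respond (matchingAt t) (promote (matchingAt t) (stateAt t))
    ... | e , edges≡ = e , trans edges≡ (cong (_++ [ e ]) (edges-promote (matchingAt t) (stateAt t)))

    createsAt : ℕ → Bool
    createsAt t = createsIsolated (matchingAt t) (promote (matchingAt t) (stateAt t))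

    created-stateAt : ∀ t → created (stateAt (suc t)) ≡ created (stateAt t) + (if createsAt t then 1 else 0)
    created-stateAt t = trans (created-respond M (promote M S)) (cong (_+ (if createsAt t then 1 else 0)) (created-promote M S))
      where
      M = matchingAt t
      S = stateAt t

    private
      take-length-++ : ∀ {X : Set} (xs ys : List X) → take (length xs) (xs ++ ys) ≡ xs
      take-length-++ [] ys = refl
      take-length-++ (x ∷ xs) ys = cong (x ∷_) (take-length-++ xs ys)

    run-∷ʳ : ∀ (es : List (Edge N)) e → run A N (es ++ [ e ]) (length es) ≡ run A N es (length es)
    run-∷ʳ [] e = refl
    run-∷ʳ es@(_ ∷ _) e = cong (A N) (trans (take-length-++ es [ e ]) (sym (take-all (length es) es ≤-refl)))

    invariant-initial : Invariant 0 (stateAt 0) []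
    invariant-initial = record
      { length-edges = refl ; simple = [] , [] ; next≤ = z≤n
      ; wellFormed = record
          { distinct = [] ; bounded = λ () ; edge-linked = λ () ; linked-edge = λ { (here refl) → ⊥-elim ∘ Consecutive-[] } }
      ; path≤m = z≤n ; pendant⇒complete = λ () ; gadgets-complete = []
      ; path-covered = [] ; pendant-free = λ () ; gadgets-locked = []
      ; matching = [] , [] ; created≡ = sym (*-zeroʳ m) ; time≤ = z≤n
      }

    stable-bounds : ∀ {s S M} → Invariant s S M → Stable M S →
                    Σ ℕ λ opt → IsOPT (edges S) opt × created S ≤ opt × suc m * length M ≤ m * opt + m
    stable-bounds {S = state es u pool ps nothing L F} {M} I (refl , incomplete , no-matched) =
      length optimum , optimum-IsOPT ,
      subst (F ≤_) (sym length-optimum) (created≤optimum m F (length pool) (length ps) (length L) created≡) ,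
      subst (λ opt → suc m * length M ≤ m * opt + m) (sym length-optimum)
        (ratio-bound m₀ (length M) (length pool) (length ps) (length L) alg-bound (≤-pred (≤∧≢⇒< path≤m incomplete)))
      where
      open Invariant I
      open StableState I (pick-nothing (bothCovered M) pool no-matched)

    last-creation : ∀ τ B → B < created (stateAt τ) → Σ ℕ λ s → s < τ × createsAt s ≡ true × B ≤ created (stateAt s)
    last-creation zero B ()
    last-creation (suc τ) B B<created with createsAt τ in creates | created-stateAt τ
    ... | true | created≡ = τ , ≤-refl , creates , ≤-pred (subst (B <_) (trans created≡ (+-comm _ 1)) B<created)
    ... | false | created≡ with last-creation τ B (subst (B <_) (trans created≡ (+-identityʳ _)) B<created)
    ...   | s , s<τ , creates' , B≤created = s , m≤n⇒m≤1+n s<τ , creates' , B≤created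

    module _ (valid : Valid (m * 2) A) (τ : ℕ) (room : ∀ t → t < τ → Room t) where

      invariant : ∀ t → t ≤ τ → Invariant t (stateAt t) (matchingAt t)
      invariant zero _ = invariant-initial
      invariant (suc t) t<τ = proj₂ step mat' budget mono
        where
        I = invariant t (≤-trans (n≤1+n t) t<τ)
        S = stateAt t
        M = matchingAt t
        step = respond-invariant (promote-invariant I) (promote-Promoted M S) (room t t<τ)
        es = edges (stateAt (suc t))
        e = proj₁ (edges-stateAt t)
        es≡ : es ≡ edges S ++ [ e ]
        es≡ = proj₂ (edges-stateAt t)
        length-es : length es ≡ suc t
        length-es = trans (cong length es≡) (trans (length-∷ʳ (edges S) e) (cong suc (Invariant.length-edges I)))
        rules = valid N es (proj₁ step) t (≤-reflexive (sym length-es))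
        previous : run A N es t ≡ M
        previous = begin
          run A N es t                          ≡⟨ cong (λ E → run A N E t) es≡ ⟩
          run A N (edges S ++ [ e ]) t          ≡⟨ cong (run A N (edges S ++ [ e ])) (Invariant.length-edges I) ⟨
          run A N (edges S ++ [ e ]) (length (edges S)) ≡⟨ run-∷ʳ (edges S) e ⟩
          run A N (edges S) (length (edges S))  ≡⟨ cong (run A N (edges S)) (Invariant.length-edges I) ⟩
          M                                     ∎
          where open ≡-Reasoning
        mat' : IsMatching es (matchingAt (suc t))
        mat' = subst (λ E → IsMatching E (matchingAt (suc t))) (take-all (suc t) es (≤-reflexive length-es)) (proj₁ rules)
        budget : reassignments M (matchingAt (suc t)) ≤ m * 2
        budget = subst (λ M₀ → reassignments M₀ (matchingAt (suc t)) ≤ m * 2) previous (proj₁ (proj₂ rules))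
        mono : ∀ {z} → Covered z M → Covered z (matchingAt (suc t))
        mono {z} z-covered = proj₂ (proj₂ rules) z (subst (Covered z) (sym previous) z-covered)

      time-bound : τ ≤ 4 * created (stateAt τ) + 1
      time-bound = bound (stateAt τ) (invariant τ ≤-refl)
        where
        bound : ∀ S → Invariant τ S (matchingAt τ) → τ ≤ 4 * created S + 1
        bound (state _ _ pool ps h L F) I =
          time≤4created+1 m₀ τ F (length pool) (length ps) (length L) (pendantCount h)
                          (Invariant.created≡ I) (Invariant.time≤ I) (pendantCount≤1 h)

      hard-state : ∀ B → 4 * B + 5 ≤ τ →
        Σ ℕ λ s → Σ ℕ λ opt → SimpleGraph (edges (stateAt s)) × IsOPT (edges (stateAt s)) opt × B ≤ opt ×
                              suc m * length (run A N (edges (stateAt s)) (length (edges (stateAt s)))) ≤ m * opt + m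
      hard-state B 4B+5≤τ with last-creation τ B B<created
        where
        B<created : B < created (stateAt τ)
        B<created = ≮⇒≥ λ created≤B → <-irrefl refl (begin-strict
          4 * B + 1          <⟨ +-monoʳ-< (4 * B) (s≤s (s≤s z≤n)) ⟩
          4 * B + 5          ≤⟨ ≤-trans 4B+5≤τ time-bound ⟩
          4 * created (stateAt τ) + 1   ≤⟨ +-monoˡ-≤ 1 (*-monoʳ-≤ 4 (≤-pred created≤B)) ⟩
          4 * B + 1          ∎)
          where open ≤-Reasoning
      ... | s , s<τ , creates , B≤created
          with stable-bounds (promote-invariant I) (createsIsolated⇒Stable M (promote M S) creates)
        where
        S = stateAt s
        M = matchingAt s
        I = invariant s (<⇒≤ s<τ)
      ... | opt , isOPT , created≤opt , ratio =
        s , opt , Invariant.simple I , subst (λ es → IsOPT es opt) (edges-promote M S) isOPT ,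
        ≤-trans B≤created (subst (_≤ opt) (created-promote M S) created≤opt) ,
        subst (λ t → suc m * length (run A N (edges S) t) ≤ m * opt + m) (sym (Invariant.length-edges I)) ratio
        where
        S = stateAt s
        M = matchingAt s
        I = invariant s (<⇒≤ s<τ)

  hard-instance : ∀ (A : Algorithm) m₀ → Valid (suc m₀ * 2) A → ∀ B →
    Σ ℕ λ n → Σ (List (Edge n)) λ es → Σ ℕ λ opt →
      SimpleGraph es × IsOPT es opt × B ≤ opt × suc (suc m₀) * size (run A n es (length es)) ≤ suc m₀ * opt + suc m₀
  hard-instance A m₀ valid B =
    let (s , opt , simple , isOPT , B≤opt , ratio) = hard-state valid τ room B ≤-refl
    in N , State.edges (stateAt s) , opt , simple , isOPT , B≤opt , ratio
    where
    τ = 4 * B + 5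
    open Adversary A m₀ (suc (τ + τ))
    room : ∀ t → t < τ → Room t
    room t t<τ = s≤s (s≤s (+-mono-≤ (<⇒≤ t<τ) (<⇒≤ t<τ)))

module RationalBound where

  open import Data.Empty using (⊥-elim)
  open import Data.Integer as ℤ using (+_; +[1+_]; -[1+_])
  import Data.Integer.Properties as ℤ
  open import Data.Nat as ℕ using (ℕ; suc)
  import Data.Nat.Properties as ℕ
  open import Data.Nat.Tactic.RingSolver using (solve-∀)
  open import Data.Rational using (ℚ; mkℚ; _/_; _+_; _-_; _*_; -_; _≤_; _<_; 0ℚ; 1ℚ; toℚᵘ; NonNegative; positive; nonNegative)
  open ℚ using (numerator; denominatorℕ)
  open import Data.Rational.Properties
  open import Data.Rational.Solver using (module +-*-Solver)
  open import Data.Rational.Unnormalised as ℚᵘ using (mkℚᵘ; *≡*; *≤*) renaming (_≃_ to _≃ᵘ_)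
  import Data.Rational.Unnormalised.Properties as ℚᵘ
  open import Relation.Binary.PropositionalEquality using (_≡_; refl; sym; trans; cong; cong₂; subst; subst₂)
  open import Relation.Nullary using (¬_)
  open +-*-Solver using (solve; _:+_; _:*_; :-_; _:-_; con; _:=_)

  private
    ℕtoℚ≃ : ∀ a → toℚᵘ (ℕtoℚ a) ≃ᵘ mkℚᵘ (+ a) 0
    ℕtoℚ≃ a = toℚᵘ-fromℚᵘ (mkℚᵘ (+ a) 0)

    pos-*-* : ∀ a b c d e → a ℕ.* b ℕ.* c ≡ d ℕ.* e → (+ a ℤ.* + b) ℤ.* + c ≡ + d ℤ.* + e
    pos-*-* a b c d e eq =
      trans (cong (ℤ._* + c) (sym (ℤ.pos-* a b))) (trans (sym (ℤ.pos-* (a ℕ.* b) c)) (trans (cong +_ eq) (ℤ.pos-* d e)))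

  ℕtoℚ-+ : ∀ a b → ℕtoℚ (a ℕ.+ b) ≡ ℕtoℚ a + ℕtoℚ b
  ℕtoℚ-+ a b = toℚᵘ-injective (ℚᵘ.≃-trans (ℕtoℚ≃ (a ℕ.+ b))
    (ℚᵘ.≃-sym (ℚᵘ.≃-trans (toℚᵘ-homo-+ (ℕtoℚ a) (ℕtoℚ b)) (ℚᵘ.≃-trans (ℚᵘ.+-cong (ℕtoℚ≃ a) (ℕtoℚ≃ b)) sum≃))))
    where
    sum≃ : mkℚᵘ (+ a) 0 ℚᵘ.+ mkℚᵘ (+ b) 0 ≃ᵘ mkℚᵘ (+ (a ℕ.+ b)) 0
    sum≃ = *≡* (trans (ℤ.*-identityʳ _) (trans (cong₂ ℤ._+_ (ℤ.*-identityʳ (+ a)) (ℤ.*-identityʳ (+ b)))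
                                                (sym (trans (ℤ.*-identityʳ _) (ℤ.pos-+ a b)))))

  ℕtoℚ-* : ∀ a b → ℕtoℚ (a ℕ.* b) ≡ ℕtoℚ a * ℕtoℚ b
  ℕtoℚ-* a b = toℚᵘ-injective (ℚᵘ.≃-trans (ℕtoℚ≃ (a ℕ.* b))
    (ℚᵘ.≃-sym (ℚᵘ.≃-trans (toℚᵘ-homo-* (ℕtoℚ a) (ℕtoℚ b)) (ℚᵘ.≃-trans (ℚᵘ.*-cong (ℕtoℚ≃ a) (ℕtoℚ≃ b)) product≃))))
    where
    product≃ : mkℚᵘ (+ a) 0 ℚᵘ.* mkℚᵘ (+ b) 0 ≃ᵘ mkℚᵘ (+ (a ℕ.* b)) 0
    product≃ = *≡* (cong (ℤ._* + 1) (sym (ℤ.pos-* a b)))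

  ℕtoℚ-mono-≤ : ∀ {a b} → a ℕ.≤ b → ℕtoℚ a ≤ ℕtoℚ b
  ℕtoℚ-mono-≤ {a} {b} a≤b = toℚᵘ-cancel-≤ (ℚᵘ.≤-respˡ-≃ (ℚᵘ.≃-sym (ℕtoℚ≃ a)) (ℚᵘ.≤-respʳ-≃ (ℚᵘ.≃-sym (ℕtoℚ≃ b))
    (*≤* (subst₂ ℤ._≤_ (sym (ℤ.*-identityʳ (+ a))) (sym (ℤ.*-identityʳ (+ b))) (ℤ.+≤+ a≤b)))))

  ℕtoℚ-nonNeg : ∀ a → NonNegative (ℕtoℚ a)
  ℕtoℚ-nonNeg a = normalize-nonNeg a 1

  *-denominator : ∀ (p : ℚ) → NonNegative p → p * ℕtoℚ (denominatorℕ p) ≡ ℕtoℚ ℤ.∣ numerator p ∣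
  *-denominator p@(mkℚ (+ n) d-1 _) _ = toℚᵘ-injective (ℚᵘ.≃-trans (toℚᵘ-homo-* p (ℕtoℚ (suc d-1)))
    (ℚᵘ.≃-trans (ℚᵘ.*-congˡ {mkℚᵘ (+ n) d-1} (ℕtoℚ≃ (suc d-1))) (ℚᵘ.≃-trans cancel≃ (ℚᵘ.≃-sym (ℕtoℚ≃ n)))))
    where
    rearrange : ∀ n d-1 → n ℕ.* suc d-1 ℕ.* 1 ≡ n ℕ.* (suc d-1 ℕ.* 1)
    rearrange = solve-∀
    cancel≃ : mkℚᵘ (+ n) d-1 ℚᵘ.* mkℚᵘ (+ suc d-1) 0 ≃ᵘ mkℚᵘ (+ n) 0
    cancel≃ = *≡* (pos-*-* n (suc d-1) 1 n (suc d-1 ℕ.* 1) (rearrange n d-1))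

  2/[2+2m]*[1+m]≡1 : ∀ m → (+ 2 / (2 ℕ.+ m ℕ.* 2)) * ℕtoℚ (suc m) ≡ 1ℚ
  2/[2+2m]*[1+m]≡1 m = toℚᵘ-injective (ℚᵘ.≃-trans (toℚᵘ-homo-* (+ 2 / (2 ℕ.+ m ℕ.* 2)) (ℕtoℚ (suc m)))
    (ℚᵘ.≃-trans (ℚᵘ.*-cong (toℚᵘ-fromℚᵘ (mkℚᵘ (+ 2) (suc (m ℕ.* 2)))) (ℕtoℚ≃ (suc m)))
                (ℚᵘ.≃-trans product≃ (ℚᵘ.≃-sym (ℕtoℚ≃ 1)))))
    where
    rearrange : ∀ m → 2 ℕ.* suc m ℕ.* 1 ≡ 1 ℕ.* (suc (suc (m ℕ.* 2)) ℕ.* 1)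
    rearrange = solve-∀
    product≃ : mkℚᵘ (+ 2) (suc (m ℕ.* 2)) ℚᵘ.* mkℚᵘ (+ suc m) 0 ≃ᵘ mkℚᵘ (+ 1) 0
    product≃ = *≡* (pos-*-* 2 (suc m) 1 1 (suc (suc (m ℕ.* 2)) ℕ.* 1) (rearrange m))

  ℕtoℚ-cancel-≤ : ∀ {a b} → ℕtoℚ a ≤ ℕtoℚ b → a ℕ.≤ b
  ℕtoℚ-cancel-≤ {a} {b} a≤b with ℚᵘ.≤-respˡ-≃ (ℕtoℚ≃ a) (ℚᵘ.≤-respʳ-≃ (ℕtoℚ≃ b) (toℚᵘ-mono-≤ a≤b))
  ... | *≤* a*1≤b*1 = ℤ.drop‿+≤+ (subst₂ ℤ._≤_ (ℤ.*-identityʳ (+ a)) (ℤ.*-identityʳ (+ b)) a*1≤b*1)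

  ∣numerator∣≥1 : ∀ (ε : ℚ) → 0ℚ < ε → 1 ℕ.≤ ℤ.∣ numerator ε ∣
  ∣numerator∣≥1 (mkℚ +[1+ _ ] _ _) _ = ℕ.s≤s ℕ.z≤n
  ∣numerator∣≥1 ε@(mkℚ (+ 0) _ _) ε>0 = ⊥-elim (ℤ.Positive.pos (positive {ε} ε>0))
  ∣numerator∣≥1 ε@(mkℚ -[1+ _ ] _ _) ε>0 = ⊥-elim (ℤ.Positive.pos (positive {ε} ε>0))

  threshold : ℚ → ℚ → ℕ
  threshold ε c = denominatorℕ ε ℕ.* (ℤ.∣ numerator c ∣ ℕ.+ denominatorℕ c)

  c+1≤ε*threshold : ∀ ε c → 0ℚ < ε → 0ℚ ≤ c → c + 1ℚ ≤ ε * ℕtoℚ (threshold ε c)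
  c+1≤ε*threshold ε c ε>0 c≥0 = begin
    c + 1ℚ
      ≤⟨ +-mono-≤ c≤∣c∣ (ℕtoℚ-mono-≤ 1≤den) ⟩
    ℕtoℚ ∣c∣ + ℕtoℚ (denominatorℕ c)
      ≡⟨ ℕtoℚ-+ ∣c∣ (denominatorℕ c) ⟨
    ℕtoℚ K
      ≤⟨ ℕtoℚ-mono-≤ (ℕ.≤-trans (ℕ.≤-reflexive (sym (ℕ.*-identityˡ K))) (ℕ.*-monoˡ-≤ K (∣numerator∣≥1 ε ε>0))) ⟩
    ℕtoℚ (∣ε∣ ℕ.* K)
      ≡⟨ ℕtoℚ-* ∣ε∣ K ⟩
    ℕtoℚ ∣ε∣ * ℕtoℚ K
      ≡⟨ cong (_* ℕtoℚ K) (*-denominator ε (nonNegative (<⇒≤ ε>0))) ⟨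
    ε * ℕtoℚ (denominatorℕ ε) * ℕtoℚ K
      ≡⟨ *-assoc ε (ℕtoℚ (denominatorℕ ε)) (ℕtoℚ K) ⟩
    ε * (ℕtoℚ (denominatorℕ ε) * ℕtoℚ K)
      ≡⟨ cong (ε *_) (ℕtoℚ-* (denominatorℕ ε) K) ⟨
    ε * ℕtoℚ (threshold ε c)
      ∎
    where
    open ≤-Reasoning
    ∣ε∣ = ℤ.∣ numerator ε ∣
    ∣c∣ = ℤ.∣ numerator c ∣
    K = ∣c∣ ℕ.+ denominatorℕ c
    1≤den : 1 ℕ.≤ denominatorℕ c
    1≤den = ℕ.s≤s ℕ.z≤n
    c≤∣c∣ : c ≤ ℕtoℚ ∣c∣
    c≤∣c∣ = begin
      c                            ≡⟨ *-identityʳ c ⟨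
      c * 1ℚ                       ≤⟨ *-monoˡ-≤-nonNeg c {{nonNegative c≥0}} (ℕtoℚ-mono-≤ 1≤den) ⟩
      c * ℕtoℚ (denominatorℕ c)    ≡⟨ *-denominator c (nonNegative c≥0) ⟩
      ℕtoℚ ∣c∣                     ∎

  ratio-unattainable : ∀ m₀ (ε c : ℚ) (opt alg : ℕ) → 0ℚ < ε → 0ℚ ≤ c → threshold ε c ℕ.≤ opt →
                       suc (suc m₀) ℕ.* alg ℕ.≤ suc m₀ ℕ.* opt ℕ.+ suc m₀ →
                       ¬ (ratio (suc m₀ ℕ.* 2) ε * ℕtoℚ opt - c ≤ ℕtoℚ alg)
  ratio-unattainable m₀ ε c opt alg ε>0 c≥0 threshold≤opt alg≤ competitive =
    ℕ.m+1+n≰m (m ℕ.* opt ℕ.+ m) (ℕtoℚ-cancel-≤ (begin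
      ℕtoℚ (m ℕ.* opt ℕ.+ m ℕ.+ 1)
        ≡⟨ trans (ℕtoℚ-+ (m ℕ.* opt ℕ.+ m) 1) (cong (_+ 1ℚ) (trans (ℕtoℚ-+ (m ℕ.* opt) m) (cong (_+ M) (ℕtoℚ-* m opt)))) ⟩
      M * O + M + 1ℚ
        ≡⟨ solve 2 (λ M O → M :* O :+ M :+ con 1ℚ := M :* O :+ (M :+ con 1ℚ) :* con 1ℚ) refl M O ⟩
      M * O + (M + 1ℚ) * 1ℚ
        ≡⟨ cong (λ x → M * O + x * 1ℚ) P≡M+1 ⟨
      M * O + P * 1ℚ
        ≤⟨ +-monoʳ-≤ (M * O) (*-monoˡ-≤-nonNeg P {{ℕtoℚ-nonNeg (suc m)}} 1≤εO-c) ⟩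
      M * O + P * (ε * O - c)
        ≡⟨ scaled ⟨
      P * (ratio (m ℕ.* 2) ε * O - c)
        ≤⟨ *-monoˡ-≤-nonNeg P {{ℕtoℚ-nonNeg (suc m)}} competitive ⟩
      P * ℕtoℚ alg
        ≡⟨ ℕtoℚ-* (suc m) alg ⟨
      ℕtoℚ (suc m ℕ.* alg)
        ≤⟨ ℕtoℚ-mono-≤ alg≤ ⟩
      ℕtoℚ (m ℕ.* opt ℕ.+ m)
        ∎))
    where
    open ≤-Reasoning
    m = suc m₀
    M = ℕtoℚ m
    P = ℕtoℚ (suc m)
    O = ℕtoℚ opt
    q = + 2 / (2 ℕ.+ m ℕ.* 2)
    P≡M+1 : P ≡ M + 1ℚ
    P≡M+1 = trans (cong ℕtoℚ (ℕ.+-comm 1 m)) (ℕtoℚ-+ m 1)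
    scaled : P * (ratio (m ℕ.* 2) ε * O - c) ≡ M * O + P * (ε * O - c)
    scaled = begin-equality
      P * ((1ℚ - q + ε) * O - c)
        ≡⟨ solve 5 (λ P q e O c → P :* ((con 1ℚ :- q :+ e) :* O :- c) := (P :- q :* P) :* O :+ P :* (e :* O :- c))
                   refl P q ε O c ⟩
      (P - q * P) * O + P * (ε * O - c)
        ≡⟨ cong (λ x → (P - x) * O + P * (ε * O - c)) (2/[2+2m]*[1+m]≡1 m) ⟩
      (P - 1ℚ) * O + P * (ε * O - c)
        ≡⟨ cong (λ x → (x - 1ℚ) * O + P * (ε * O - c)) P≡M+1 ⟩
      (M + 1ℚ - 1ℚ) * O + P * (ε * O - c)
        ≡⟨ solve 3 (λ M O Z → (M :+ con 1ℚ :- con 1ℚ) :* O :+ Z := M :* O :+ Z) refl M O (P * (ε * O - c)) ⟩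
      M * O + P * (ε * O - c)
        ∎
    1≤εO-c : 1ℚ ≤ ε * O - c
    1≤εO-c = begin
      1ℚ            ≡⟨ solve 1 (λ c → c :+ con 1ℚ :- c := con 1ℚ) refl c ⟨
      c + 1ℚ - c    ≤⟨ +-monoˡ-≤ (- c) (≤-trans (c+1≤ε*threshold ε c ε>0 c≥0) ε*threshold≤ε*O) ⟩
      ε * O - c     ∎
      where
      ε*threshold≤ε*O : ε * ℕtoℚ (threshold ε c) ≤ ε * O
      ε*threshold≤ε*O = *-monoˡ-≤-nonNeg ε {{nonNegative (<⇒≤ ε>0)}} (ℕtoℚ-mono-≤ threshold≤opt)

open Construction using (hard-instance)
open RationalBound using (threshold; ratio-unattainable)
open import Data.Nat using (ℕ; zero; suc) renaming (_<_ to _<ℕ_)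
open import Data.List using (length)
open import Data.Nat.Divisibility using (_∣_; divides)
open import Data.Product using (_,_)
open import Data.Rational using (ℚ; 0ℚ; _<_)
open import Relation.Binary.PropositionalEquality using (refl)
open import Relation.Nullary using (¬_)

theorem6 : (k : ℕ) → 0 <ℕ k → 2 ∣ k →
           (ε : ℚ) → 0ℚ < ε →
           (A : Algorithm) → ¬ Competitive k (ratio k ε) A
theorem6 _ () (divides zero refl) _ _ _ _
theorem6 _ _ (divides (suc m₀) refl) ε ε>0 A (valid , c , c≥0 , competitive) =
  let (n , es , opt , simple , isOPT , threshold≤opt , alg≤) = hard-instance A m₀ valid (threshold ε c)
  in ratio-unattainable m₀ ε c opt (size (run A n es (length es))) ε>0 c≥0 threshold≤opt alg≤ (competitive n es simple opt isOPT)
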